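{- Let $q$ be a prime power, $\Lambda(X)=X^q-X$, and let $k<q$ and $t\ge1$ be integers. Let $C(X)\in\mathbb{F}_q[X]$ be a nonzero polynomial of the form $$C(X)=\sum_{i=0}^{t-1}C_i(X)\Lambda^i(X),$$ where $C_i(X)\in\mathbb{F}_q[X]$ and $\deg(C_i)\le k$ for all $i$. Let $H(X)\in\mathbb{F}_q[X]$ be irreducible and let $\mu$ be the largest integer such that $H(X)^\mu$ divides $C(X)$. Then $\mu \bmod q\in[0,k+t-1]$.
   Context: $\mu \bmod q$ denotes the residue of $\mu$ in $\{0,1,\dots,q-1\}$. -}

module Defs where

open import Level using (Level; _⊔_)
open import Algebra.Bundles using (CommutativeRing)
open import Data.Nat as ℕ using (ℕ; zero; suc; _<_; _≤_)
open import Data.Nat.Primality using (Prime)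
open import Data.Fin using (Fin) renaming (zero to fzero; suc to fsuc)
open import Data.List using (List; []; _∷_)
open import Data.Product using (Σ; ∃; _×_; _,_)
open import Data.Sum using (_⊎_)
open import Relation.Nullary using (¬_)
open import Relation.Binary.PropositionalEquality using (_≡_)

IsPrimePower : ℕ → Set
IsPrimePower q = Σ ℕ λ p → Σ ℕ λ e → Prime p × 1 ≤ e × q ≡ p ℕ.^ e

module _ {c ℓ : Level} (R : CommutativeRing c ℓ) where
  open CommutativeRing R

  IsField : Set (c ⊔ ℓ)
  IsField = (¬ (1# ≈ 0#)) × (∀ x → ¬ (x ≈ 0#) → ∃ λ y → x * y ≈ 1#)

  HasCardinality : ℕ → Set (c ⊔ ℓ)
  HasCardinality q = Σ (Fin q → Carrier) λ enum →
    (∀ i j → enum i ≈ enum j → i ≡ j) × (∀ x → ∃ λ i → enum i ≈ x)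

module Poly {c ℓ : Level} (R : CommutativeRing c ℓ) where
  open CommutativeRing R

  -- polynomials as coefficient lists, lowest degree first
  Poly : Set c
  Poly = List Carrier

  coeff : Poly → ℕ → Carrier
  coeff []      n       = 0#
  coeff (a ∷ p) zero    = a
  coeff (a ∷ p) (suc n) = coeff p n

  _≈ₚ_ : Poly → Poly → Set ℓ
  p ≈ₚ q = ∀ n → coeff p n ≈ coeff q n

  0ₚ : Poly
  0ₚ = []

  1ₚ : Poly
  1ₚ = 1# ∷ []

  Xₚ : Poly
  Xₚ = 0# ∷ 1# ∷ []

  _+ₚ_ : Poly → Poly → Poly
  []      +ₚ q       = q
  (a ∷ p) +ₚ []      = a ∷ p
  (a ∷ p) +ₚ (b ∷ q) = (a + b) ∷ (p +ₚ q)

  -ₚ_ : Poly → Poly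
  -ₚ []      = []
  -ₚ (a ∷ p) = (- a) ∷ (-ₚ p)

  _·ₚ_ : Carrier → Poly → Poly
  a ·ₚ []      = []
  a ·ₚ (b ∷ q) = (a * b) ∷ (a ·ₚ q)

  _*ₚ_ : Poly → Poly → Poly
  []      *ₚ q = []
  (a ∷ p) *ₚ q = (a ·ₚ q) +ₚ (0# ∷ (p *ₚ q))

  _^ₚ_ : Poly → ℕ → Poly
  p ^ₚ zero  = 1ₚ
  p ^ₚ suc n = p *ₚ (p ^ₚ n)

  -- deg p ≤ k  (the zero polynomial has degree -∞, so satisfies it)
  DegLe : Poly → ℕ → Set ℓ
  DegLe p k = ∀ n → k < n → coeff p n ≈ 0#

  _∣ₚ_ : Poly → Poly → Set (c ⊔ ℓ)
  a ∣ₚ b = ∃ λ r → (r *ₚ a) ≈ₚ b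

  IsUnitₚ : Poly → Set (c ⊔ ℓ)
  IsUnitₚ p = ∃ λ u → (p *ₚ u) ≈ₚ 1ₚ

  Irreducible : Poly → Set (c ⊔ ℓ)
  Irreducible h = (¬ (h ≈ₚ 0ₚ)) × (¬ IsUnitₚ h) ×
    (∀ a b → h ≈ₚ (a *ₚ b) → IsUnitₚ a ⊎ IsUnitₚ b)

  sumₚ : (t : ℕ) → (Fin t → Poly) → Poly
  sumₚ zero    f = 0ₚ
  sumₚ (suc t) f = f fzero +ₚ sumₚ t (λ i → f (fsuc i))

  Λ : ℕ → Poly
  Λ q = (Xₚ ^ₚ q) +ₚ (-ₚ Xₚ)

-- Write μ = a q + m with m = μ mod q, so that C = (H^a)^q · H^m r.  The Taylor map
-- P ↦ P(X + Y) = Σⱼ Pⱼ(X) Yʲ is a ring homomorphism F[X] → F[X][Y], and as q is a power of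
-- the characteristic, G(X + Y)^q ≡ G(X)^q modulo Y^q.  Hence for j < q the coefficient Cⱼ is
-- (H^a)^q times the j-th coefficient of (H^m r)(X + Y), and for j = m that coefficient is
-- congruent to (H′)^m r modulo H.  On the other hand Λ(X + Y) = Λ(X) − Y + Y^q, so modulo Y^q
-- the expansion of C has Y-degree at most k + t − 1.  So if m > k + t − 1 then Cₘ = 0 and
-- H ∣ (H′)^m r.  Since H is irreducible over the perfect field F, H ∤ H′; hence H ∣ r and
-- H^(μ+1) ∣ C.

module Submission where

open import Level using (Level; _⊔_)
open import Algebra.Bundles using (CommutativeRing; CommutativeMonoid)
open import Data.Nat as ℕ using (ℕ; zero; suc; _<_; _≤_; _∸_; _!; z≤n; s≤s; z<s; NonZero)
import Data.Nat.Properties as ℕ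
open import Data.List using (List; []; _∷_; drop; length)
open import Data.List.Properties using (length-drop)
open import Data.Product using (_,_; ∃; proj₁; proj₂)
open import Relation.Binary.Bundles using (Setoid)
open import Relation.Binary.PropositionalEquality as ≡ using (_≡_)
import Relation.Binary.Reasoning.Setoid as Reasoning
import Data.Nat.Divisibility as ℕ
open import Data.Nat.DivMod using (m/n*n≡m)
open import Data.Nat.Primality using (Prime; euclidsLemma; prime⇒nonZero; prime⇒nonTrivial; prime⇒irreducible)
open import Data.Nat.Coprimality using (Coprime; coprime-Bézout)
import Data.Nat.GCD as ℕ
import Data.Nat.Combinatorics as ℕ
open import Data.Fin using (Fin; toℕ; fromℕ) renaming (zero to fzero; suc to fsuc)
import Data.Fin as Fin
open import Data.Fin.Permutation using (permutation)
import Data.Fin.Properties as Fin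
open import Data.Fin.Properties using (toℕ-fromℕ; toℕ<n)
open import Data.Sum using (_⊎_; inj₁; inj₂)
open import Data.Empty using (⊥-elim)
open import Relation.Nullary using (¬_; Dec; yes; no)
open import Defs

prime>1 : ∀ {p} → Prime p → 1 < p
prime>1 {p} p-prime = ℕ.nonTrivial⇒n>1 p {{prime⇒nonTrivial p-prime}}

prime∤! : ∀ {p} → Prime p → ∀ {j} → j < p → ¬ (p ℕ.∣ j !)
prime∤! {p} p-prime {zero}  _   p∣1    = ℕ.<-irrefl ≡.refl (ℕ.<-≤-trans (prime>1 p-prime) (ℕ.∣⇒≤ p∣1))
prime∤! {p} p-prime {suc j} j<p p∣j+1! with euclidsLemma (suc j) (j !) p-prime p∣j+1!
... | inj₁ p∣j+1 = ℕ.<-irrefl ≡.refl (ℕ.<-≤-trans j<p (ℕ.∣⇒≤ p∣j+1))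
... | inj₂ p∣j!  = prime∤! p-prime (ℕ.<-trans (ℕ.n<1+n j) j<p) p∣j!

prime∣binomial : ∀ {p k} → Prime p → 0 < k → k < p → p ℕ.∣ p ℕ.C k
prime∣binomial {p} {k} p-prime 0<k k<p with euclidsLemma (p ℕ.C k) (k ! ℕ.* (p ∸ k) !) p-prime p∣C*k!*[p-k]!
  where
  instance _ = k ℕ.!* (p ∸ k) !≢0
  p∣C*k!*[p-k]! : p ℕ.∣ (p ℕ.C k) ℕ.* (k ! ℕ.* (p ∸ k) !)
  C*k!*[p-k]!≡p! : (p ℕ.C k) ℕ.* (k ! ℕ.* (p ∸ k) !) ≡ p !
  C*k!*[p-k]!≡p! = ≡.trans (≡.cong (ℕ._* (k ! ℕ.* (p ∸ k) !)) (ℕ.nCk≡n!/k![n-k]! (ℕ.<⇒≤ k<p)))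
                           (m/n*n≡m (ℕ.k![n∸k]!∣n! (ℕ.<⇒≤ k<p)))
  p∣C*k!*[p-k]! = ≡.subst (p ℕ.∣_) (≡.sym C*k!*[p-k]!≡p!) (n∣n! p (prime⇒nonZero p-prime))
    where
    n∣n! : ∀ n → NonZero n → n ℕ.∣ n !
    n∣n! (suc n) _ = ℕ.m∣m*n (n !)
... | inj₁ p∣C = p∣C
... | inj₂ p∣k!*[p-k]! with euclidsLemma (k !) ((p ∸ k) !) p-prime p∣k!*[p-k]!
...   | inj₁ p∣k!     = ⊥-elim (prime∤! p-prime k<p p∣k!)
...   | inj₂ p∣[p-k]! = ⊥-elim (prime∤! p-prime (ℕ.∸-monoʳ-< 0<k (ℕ.<⇒≤ k<p)) p∣[p-k]!)

module Frobenius {c ℓ : Level} (R : CommutativeRing c ℓ) where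
  open CommutativeRing R hiding (zero)
  open import Algebra.Properties.Semiring.Mult semiring using (_×_; ×-congʳ; ×-cong; ×-comm-*; ×1-homo-*)
  open import Algebra.Properties.Semiring.Exp semiring using (_^_; ^-congˡ; ^-congʳ; ^-assocʳ)
  open import Algebra.Properties.CommutativeSemiring.Binomial commutativeSemiring using (theorem; binomialExpansion; binomialTerm)
  open import Algebra.Properties.Monoid.Sum +-monoid using (sum)
  open Reasoning setoid

  ×-≈0 : ∀ {p n} → p × 1# ≈ 0# → ∀ x → p ℕ.∣ n → n × x ≈ 0#
  ×-≈0 {p} char-p x (ℕ.divides s ≡.refl) = begin
    (s ℕ.* p) × x               ≈⟨ ×-congʳ (s ℕ.* p) (*-identityʳ x) ⟨
    (s ℕ.* p) × (x * 1#)        ≈⟨ ×-comm-* (s ℕ.* p) x 1# ⟨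
    x * ((s ℕ.* p) × 1#)        ≈⟨ *-congˡ (×1-homo-* s p) ⟩
    x * ((s × 1#) * (p × 1#))   ≈⟨ *-congˡ (*-congˡ char-p) ⟩
    x * ((s × 1#) * 0#)         ≈⟨ *-congˡ (zeroʳ _) ⟩
    x * 0#                      ≈⟨ zeroʳ x ⟩
    0#                          ∎

  sum≈last : ∀ m (h : Fin (suc m) → Carrier) → (∀ i → toℕ i < m → h i ≈ 0#) → sum h ≈ h (fromℕ m)
  sum≈last zero    h _       = +-identityʳ _
  sum≈last (suc m) h h-low≈0 = begin
    h fzero + sum (λ i → h (fsuc i))  ≈⟨ +-cong (h-low≈0 fzero z<s) (sum≈last m _ λ i i<m → h-low≈0 (fsuc i) (s≤s i<m)) ⟩
    0# + h (fsuc (fromℕ m))           ≈⟨ +-identityˡ _ ⟩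
    h (fromℕ (suc m))                 ∎

  frobenius : ∀ {p} → Prime p → p × 1# ≈ 0# → ∀ x y → (x + y) ^ p ≈ x ^ p + y ^ p
  frobenius {zero} p-prime _ _ _ with () ← prime>1 p-prime
  frobenius {suc p′} p-prime char-p x y = begin
    (x + y) ^ suc p′                                ≈⟨ theorem (suc p′) x y ⟩
    binomialExpansion x y (suc p′)                  ≈⟨ +-congˡ (sum≈last p′ _ inner≈0) ⟩
    binomialTerm x y (suc p′) fzero + binomialTerm x y (suc p′) top   ≈⟨ +-cong first last ⟩
    y ^ suc p′ + x ^ suc p′                         ≈⟨ +-comm _ _ ⟩
    x ^ suc p′ + y ^ suc p′                         ∎
    where
    top = fsuc (fromℕ p′)
    inner≈0 : ∀ (i : Fin (suc p′)) → toℕ i < p′ → binomialTerm x y (suc p′) (fsuc i) ≈ 0#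
    inner≈0 i i<p′ = ×-≈0 char-p _ (prime∣binomial p-prime z<s (s≤s i<p′))
    first : binomialTerm x y (suc p′) fzero ≈ y ^ suc p′
    first = begin
      1 × (1# * y ^ suc p′)   ≈⟨ +-identityʳ _ ⟩
      1# * y ^ suc p′         ≈⟨ *-identityˡ _ ⟩
      y ^ suc p′              ∎
    top≡p : toℕ top ≡ suc p′
    top≡p = ≡.cong suc (toℕ-fromℕ p′)
    last : binomialTerm x y (suc p′) top ≈ x ^ suc p′
    last = begin
      (suc p′ ℕ.C toℕ top) × (x ^ toℕ top * y ^ (suc p′ ∸ toℕ top))
        ≈⟨ ×-cong (≡.cong (suc p′ ℕ.C_) top≡p) (*-cong (^-congʳ x top≡p) (^-congʳ y (≡.cong (suc p′ ∸_) top≡p))) ⟩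
      (suc p′ ℕ.C suc p′) × (x ^ suc p′ * y ^ (suc p′ ∸ suc p′))
        ≈⟨ ×-cong (ℕ.nCn≡1 (suc p′)) (*-congˡ (^-congʳ y (ℕ.n∸n≡0 (suc p′)))) ⟩
      1 × (x ^ suc p′ * 1#)
        ≈⟨ +-identityʳ _ ⟩
      x ^ suc p′ * 1#
        ≈⟨ *-identityʳ _ ⟩
      x ^ suc p′ ∎

  frobenius-^ : ∀ {p} → Prime p → p × 1# ≈ 0# → ∀ e x y → (x + y) ^ (p ℕ.^ e) ≈ x ^ (p ℕ.^ e) + y ^ (p ℕ.^ e)
  frobenius-^ p-prime char-p zero    x y = trans (*-identityʳ _) (sym (+-cong (*-identityʳ x) (*-identityʳ y)))
  frobenius-^ {p} p-prime char-p (suc e) x y = begin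
    (x + y) ^ (p ℕ.* p ℕ.^ e)                   ≈⟨ ^-assocʳ (x + y) p (p ℕ.^ e) ⟨
    ((x + y) ^ p) ^ (p ℕ.^ e)                   ≈⟨ ^-congˡ (p ℕ.^ e) (frobenius p-prime char-p x y) ⟩
    (x ^ p + y ^ p) ^ (p ℕ.^ e)                 ≈⟨ frobenius-^ p-prime char-p e (x ^ p) (y ^ p) ⟩
    (x ^ p) ^ (p ℕ.^ e) + (y ^ p) ^ (p ℕ.^ e)   ≈⟨ +-cong (^-assocʳ x p (p ℕ.^ e)) (^-assocʳ y p (p ℕ.^ e)) ⟩
    x ^ (p ℕ.* p ℕ.^ e) + y ^ (p ℕ.* p ℕ.^ e)   ∎

module Polynomial {c ℓ : Level} (R : CommutativeRing c ℓ) where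
  open CommutativeRing R hiding (zero)
  open Poly R public
  open import Algebra.Properties.Ring ring using (-0#≈0#)
  open Reasoning setoid

  -- _≈ₚ_ wrapped in a record, so that both polynomials can be inferred from an equation.
  infix 4 _≋_
  record _≋_ (p q : Poly) : Set ℓ where
    constructor mk≋
    field coeff-≈ : ∀ n → coeff p n ≈ coeff q n
  open _≋_ public

  ≋-refl : ∀ {p} → p ≋ p
  ≋-refl = mk≋ λ _ → refl

  ≋-sym : ∀ {p q} → p ≋ q → q ≋ p
  ≋-sym e = mk≋ λ n → sym (coeff-≈ e n)

  ≋-trans : ∀ {p q r} → p ≋ q → q ≋ r → p ≋ r
  ≋-trans e f = mk≋ λ n → trans (coeff-≈ e n) (coeff-≈ f n)

  ≋-reflexive : ∀ {p q} → p ≡ q → p ≋ q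
  ≋-reflexive ≡.refl = ≋-refl

  ≋-setoid : Setoid c ℓ
  ≋-setoid = record
    { Carrier = Poly ; _≈_ = _≋_
    ; isEquivalence = record { refl = ≋-refl ; sym = ≋-sym ; trans = ≋-trans } }

  ∷-cong : ∀ {a b p q} → a ≈ b → p ≋ q → (a ∷ p) ≋ (b ∷ q)
  ∷-cong a≈b p≋q = mk≋ λ where
    zero    → a≈b
    (suc n) → coeff-≈ p≋q n

  ∷-injectiveʳ : ∀ {a b p q} → (a ∷ p) ≋ (b ∷ q) → p ≋ q
  ∷-injectiveʳ e = mk≋ λ n → coeff-≈ e (suc n)

  ∷≋[]⇒≋[] : ∀ {a p} → (a ∷ p) ≋ [] → p ≋ []
  ∷≋[]⇒≋[] e = mk≋ λ n → coeff-≈ e (suc n)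

  ∷-≋[] : ∀ {a p} → a ≈ 0# → p ≋ [] → (a ∷ p) ≋ []
  ∷-≋[] a≈0 p≋[] = mk≋ λ where
    zero    → a≈0
    (suc n) → coeff-≈ p≋[] n

  coeff-+ₚ : ∀ p q n → coeff (p +ₚ q) n ≈ coeff p n + coeff q n
  coeff-+ₚ []      q       n       = sym (+-identityˡ _)
  coeff-+ₚ (a ∷ p) []      n       = sym (+-identityʳ _)
  coeff-+ₚ (a ∷ p) (b ∷ q) zero    = refl
  coeff-+ₚ (a ∷ p) (b ∷ q) (suc n) = coeff-+ₚ p q n

  coeff-·ₚ : ∀ a p n → coeff (a ·ₚ p) n ≈ a * coeff p n
  coeff-·ₚ a []      n       = sym (zeroʳ a)
  coeff-·ₚ a (b ∷ p) zero    = refl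
  coeff-·ₚ a (b ∷ p) (suc n) = coeff-·ₚ a p n

  coeff--ₚ : ∀ p n → coeff (-ₚ p) n ≈ - coeff p n
  coeff--ₚ []      n       = sym -0#≈0#
  coeff--ₚ (a ∷ p) zero    = refl
  coeff--ₚ (a ∷ p) (suc n) = coeff--ₚ p n

  +ₚ-cong : ∀ {p p′ q q′} → p ≋ p′ → q ≋ q′ → (p +ₚ q) ≋ (p′ +ₚ q′)
  +ₚ-cong {p} {p′} {q} {q′} e f = mk≋ λ n → begin
    coeff (p +ₚ q) n          ≈⟨ coeff-+ₚ p q n ⟩
    coeff p n + coeff q n     ≈⟨ +-cong (coeff-≈ e n) (coeff-≈ f n) ⟩
    coeff p′ n + coeff q′ n   ≈⟨ coeff-+ₚ p′ q′ n ⟨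
    coeff (p′ +ₚ q′) n        ∎

  ·ₚ-cong : ∀ {a b p q} → a ≈ b → p ≋ q → (a ·ₚ p) ≋ (b ·ₚ q)
  ·ₚ-cong {a} {b} {p} {q} e f = mk≋ λ n → begin
    coeff (a ·ₚ p) n   ≈⟨ coeff-·ₚ a p n ⟩
    a * coeff p n      ≈⟨ *-cong e (coeff-≈ f n) ⟩
    b * coeff q n      ≈⟨ coeff-·ₚ b q n ⟨
    coeff (b ·ₚ q) n   ∎

  -ₚ-cong : ∀ {p q} → p ≋ q → (-ₚ p) ≋ (-ₚ q)
  -ₚ-cong {p} {q} e = mk≋ λ n → begin
    coeff (-ₚ p) n   ≈⟨ coeff--ₚ p n ⟩
    - coeff p n      ≈⟨ -‿cong (coeff-≈ e n) ⟩
    - coeff q n      ≈⟨ coeff--ₚ q n ⟨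
    coeff (-ₚ q) n   ∎

  +ₚ-assoc : ∀ p q r → ((p +ₚ q) +ₚ r) ≋ (p +ₚ (q +ₚ r))
  +ₚ-assoc p q r = mk≋ λ n → begin
    coeff ((p +ₚ q) +ₚ r) n               ≈⟨ coeff-+ₚ (p +ₚ q) r n ⟩
    coeff (p +ₚ q) n + coeff r n          ≈⟨ +-congʳ (coeff-+ₚ p q n) ⟩
    (coeff p n + coeff q n) + coeff r n   ≈⟨ +-assoc _ _ _ ⟩
    coeff p n + (coeff q n + coeff r n)   ≈⟨ +-congˡ (coeff-+ₚ q r n) ⟨
    coeff p n + coeff (q +ₚ r) n          ≈⟨ coeff-+ₚ p (q +ₚ r) n ⟨
    coeff (p +ₚ (q +ₚ r)) n               ∎

  +ₚ-comm : ∀ p q → (p +ₚ q) ≋ (q +ₚ p)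
  +ₚ-comm p q = mk≋ λ n → begin
    coeff (p +ₚ q) n        ≈⟨ coeff-+ₚ p q n ⟩
    coeff p n + coeff q n   ≈⟨ +-comm _ _ ⟩
    coeff q n + coeff p n   ≈⟨ coeff-+ₚ q p n ⟨
    coeff (q +ₚ p) n        ∎

  +ₚ-identityʳ : ∀ p → (p +ₚ []) ≋ p
  +ₚ-identityʳ []      = ≋-refl
  +ₚ-identityʳ (a ∷ p) = ≋-refl

  -ₚ-inverseˡ : ∀ p → ((-ₚ p) +ₚ p) ≋ []
  -ₚ-inverseˡ p = mk≋ λ n → begin
    coeff ((-ₚ p) +ₚ p) n        ≈⟨ coeff-+ₚ (-ₚ p) p n ⟩
    coeff (-ₚ p) n + coeff p n   ≈⟨ +-congʳ (coeff--ₚ p n) ⟩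
    - coeff p n + coeff p n      ≈⟨ -‿inverseˡ _ ⟩
    0#                           ∎

  -ₚ-inverseʳ : ∀ p → (p +ₚ (-ₚ p)) ≋ []
  -ₚ-inverseʳ p = ≋-trans (+ₚ-comm p (-ₚ p)) (-ₚ-inverseˡ p)

  +ₚ-commutativeMonoid : CommutativeMonoid c ℓ
  +ₚ-commutativeMonoid = record
    { Carrier = Poly ; _≈_ = _≋_ ; _∙_ = _+ₚ_ ; ε = []
    ; isCommutativeMonoid = record
      { isMonoid = record
        { isSemigroup = record
          { isMagma = record { isEquivalence = Setoid.isEquivalence ≋-setoid ; ∙-cong = +ₚ-cong }
          ; assoc = +ₚ-assoc }
        ; identity = (λ _ → ≋-refl) , +ₚ-identityʳ }
      ; comm = +ₚ-comm } }

  open import Algebra.Properties.CommutativeSemigroup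
    (CommutativeMonoid.commutativeSemigroup +ₚ-commutativeMonoid) public
    using () renaming (interchange to +ₚ-interchange; x∙yz≈y∙xz to +ₚ-leftComm)

  ·ₚ-distribˡ-+ₚ : ∀ a p q → (a ·ₚ (p +ₚ q)) ≋ ((a ·ₚ p) +ₚ (a ·ₚ q))
  ·ₚ-distribˡ-+ₚ a p q = mk≋ λ n → begin
    coeff (a ·ₚ (p +ₚ q)) n                   ≈⟨ coeff-·ₚ a (p +ₚ q) n ⟩
    a * coeff (p +ₚ q) n                      ≈⟨ *-congˡ (coeff-+ₚ p q n) ⟩
    a * (coeff p n + coeff q n)               ≈⟨ distribˡ _ _ _ ⟩
    a * coeff p n + a * coeff q n             ≈⟨ +-cong (coeff-·ₚ a p n) (coeff-·ₚ a q n) ⟨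
    coeff (a ·ₚ p) n + coeff (a ·ₚ q) n       ≈⟨ coeff-+ₚ (a ·ₚ p) (a ·ₚ q) n ⟨
    coeff ((a ·ₚ p) +ₚ (a ·ₚ q)) n            ∎

  ·ₚ-distribʳ-+ : ∀ a b p → ((a + b) ·ₚ p) ≋ ((a ·ₚ p) +ₚ (b ·ₚ p))
  ·ₚ-distribʳ-+ a b p = mk≋ λ n → begin
    coeff ((a + b) ·ₚ p) n                    ≈⟨ coeff-·ₚ _ p n ⟩
    (a + b) * coeff p n                       ≈⟨ distribʳ _ _ _ ⟩
    a * coeff p n + b * coeff p n             ≈⟨ +-cong (coeff-·ₚ a p n) (coeff-·ₚ b p n) ⟨
    coeff (a ·ₚ p) n + coeff (b ·ₚ p) n       ≈⟨ coeff-+ₚ (a ·ₚ p) (b ·ₚ p) n ⟨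
    coeff ((a ·ₚ p) +ₚ (b ·ₚ p)) n            ∎

  ·ₚ-assoc : ∀ a b p → (a ·ₚ (b ·ₚ p)) ≋ ((a * b) ·ₚ p)
  ·ₚ-assoc a b p = mk≋ λ n → begin
    coeff (a ·ₚ (b ·ₚ p)) n   ≈⟨ coeff-·ₚ a (b ·ₚ p) n ⟩
    a * coeff (b ·ₚ p) n      ≈⟨ *-congˡ (coeff-·ₚ b p n) ⟩
    a * (b * coeff p n)       ≈⟨ *-assoc _ _ _ ⟨
    (a * b) * coeff p n       ≈⟨ coeff-·ₚ _ p n ⟨
    coeff ((a * b) ·ₚ p) n    ∎

  ·ₚ-zeroˡ : ∀ {a} p → a ≈ 0# → (a ·ₚ p) ≋ []
  ·ₚ-zeroˡ {a} p a≈0 = mk≋ λ n → trans (coeff-·ₚ a p n) (trans (*-congʳ a≈0) (zeroˡ _))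

  ·ₚ-identityˡ : ∀ p → (1# ·ₚ p) ≋ p
  ·ₚ-identityˡ p = mk≋ λ n → trans (coeff-·ₚ 1# p n) (*-identityˡ _)

  ·ₚ-∷-zero : ∀ a p → (a ·ₚ (0# ∷ p)) ≋ (0# ∷ (a ·ₚ p))
  ·ₚ-∷-zero a p = ∷-cong (zeroʳ a) ≋-refl

  ∷≋+ₚ : ∀ a p → (a ∷ p) ≋ ((a ∷ []) +ₚ (0# ∷ p))
  ∷≋+ₚ a p = ∷-cong (sym (+-identityʳ a)) ≋-refl

  ∷-zero-+ₚ : ∀ p q → (0# ∷ (p +ₚ q)) ≋ ((0# ∷ p) +ₚ (0# ∷ q))
  ∷-zero-+ₚ p q = ∷-cong (sym (+-identityʳ 0#)) ≋-refl

  *ₚ-zeroˡ : ∀ {p} q → p ≋ [] → (p *ₚ q) ≋ []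
  *ₚ-zeroˡ {[]}    q e = ≋-refl
  *ₚ-zeroˡ {a ∷ p} q e = +ₚ-cong (·ₚ-zeroˡ q (coeff-≈ e 0)) (∷-≋[] refl (*ₚ-zeroˡ q (∷≋[]⇒≋[] e)))

  *ₚ-zeroʳ : ∀ p → (p *ₚ []) ≋ []
  *ₚ-zeroʳ []      = ≋-refl
  *ₚ-zeroʳ (a ∷ p) = ∷-≋[] refl (*ₚ-zeroʳ p)

  *ₚ-congˡ : ∀ {p p′} q → p ≋ p′ → (p *ₚ q) ≋ (p′ *ₚ q)
  *ₚ-congˡ {[]}    {p′}     q e = ≋-sym (*ₚ-zeroˡ q (≋-sym e))
  *ₚ-congˡ {a ∷ p} {[]}     q e = *ₚ-zeroˡ q e
  *ₚ-congˡ {a ∷ p} {b ∷ p′} q e =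
    +ₚ-cong (·ₚ-cong (coeff-≈ e 0) ≋-refl) (∷-cong refl (*ₚ-congˡ q (∷-injectiveʳ e)))

  *ₚ-congʳ : ∀ p {q q′} → q ≋ q′ → (p *ₚ q) ≋ (p *ₚ q′)
  *ₚ-congʳ []      e = ≋-refl
  *ₚ-congʳ (a ∷ p) e = +ₚ-cong (·ₚ-cong refl e) (∷-cong refl (*ₚ-congʳ p e))

  *ₚ-cong : ∀ {p p′ q q′} → p ≋ p′ → q ≋ q′ → (p *ₚ q) ≋ (p′ *ₚ q′)
  *ₚ-cong {p′ = p′} {q} e f = ≋-trans (*ₚ-congˡ q e) (*ₚ-congʳ p′ f)

  ∷-zero-*ₚ : ∀ p q → ((0# ∷ p) *ₚ q) ≋ (0# ∷ (p *ₚ q))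
  ∷-zero-*ₚ p q = +ₚ-cong (·ₚ-zeroˡ q refl) ≋-refl

  *ₚ-distribʳ : ∀ p q r → ((p +ₚ q) *ₚ r) ≋ ((p *ₚ r) +ₚ (q *ₚ r))
  *ₚ-distribʳ []      q       r = ≋-refl
  *ₚ-distribʳ (a ∷ p) []      r = ≋-sym (+ₚ-identityʳ _)
  *ₚ-distribʳ (a ∷ p) (b ∷ q) r = ≋-trans
    (+ₚ-cong (·ₚ-distribʳ-+ a b r)
             (≋-trans (∷-cong refl (*ₚ-distribʳ p q r)) (∷-zero-+ₚ (p *ₚ r) (q *ₚ r))))
    (+ₚ-interchange (a ·ₚ r) (b ·ₚ r) (0# ∷ (p *ₚ r)) (0# ∷ (q *ₚ r)))

  *ₚ-distribˡ : ∀ p q r → (p *ₚ (q +ₚ r)) ≋ ((p *ₚ q) +ₚ (p *ₚ r))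
  *ₚ-distribˡ []      q r = ≋-refl
  *ₚ-distribˡ (a ∷ p) q r = ≋-trans
    (+ₚ-cong (·ₚ-distribˡ-+ₚ a q r)
             (≋-trans (∷-cong refl (*ₚ-distribˡ p q r)) (∷-zero-+ₚ (p *ₚ q) (p *ₚ r))))
    (+ₚ-interchange (a ·ₚ q) (a ·ₚ r) (0# ∷ (p *ₚ q)) (0# ∷ (p *ₚ r)))

  ·ₚ-*ₚ-assoc : ∀ a p r → ((a ·ₚ p) *ₚ r) ≋ (a ·ₚ (p *ₚ r))
  ·ₚ-*ₚ-assoc a []      r = ≋-refl
  ·ₚ-*ₚ-assoc a (b ∷ p) r = ≋-trans
    (+ₚ-cong (≋-sym (·ₚ-assoc a b r)) (≋-trans (∷-cong refl (·ₚ-*ₚ-assoc a p r)) (≋-sym (·ₚ-∷-zero a (p *ₚ r)))))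
    (≋-sym (·ₚ-distribˡ-+ₚ a (b ·ₚ r) (0# ∷ (p *ₚ r))))

  *ₚ-∷ : ∀ q a p → (q *ₚ (a ∷ p)) ≋ ((a ·ₚ q) +ₚ (0# ∷ (q *ₚ p)))
  *ₚ-∷ []      a p = ≋-sym (∷-≋[] refl ≋-refl)
  *ₚ-∷ (b ∷ q) a p = ∷-cong (+-congʳ (*-comm b a))
    (≋-trans (+ₚ-cong (≋-refl {b ·ₚ p}) (*ₚ-∷ q a p)) (+ₚ-leftComm (b ·ₚ p) (a ·ₚ q) (0# ∷ (q *ₚ p))))

  *ₚ-comm : ∀ p q → (p *ₚ q) ≋ (q *ₚ p)
  *ₚ-comm []      q = ≋-sym (*ₚ-zeroʳ q)
  *ₚ-comm (a ∷ p) q = ≋-trans (+ₚ-cong ≋-refl (∷-cong refl (*ₚ-comm p q))) (≋-sym (*ₚ-∷ q a p))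

  *ₚ-assoc : ∀ p q r → ((p *ₚ q) *ₚ r) ≋ (p *ₚ (q *ₚ r))
  *ₚ-assoc []      q r = ≋-refl
  *ₚ-assoc (a ∷ p) q r = ≋-trans (*ₚ-distribʳ (a ·ₚ q) (0# ∷ (p *ₚ q)) r)
    (+ₚ-cong (·ₚ-*ₚ-assoc a q r) (≋-trans (∷-zero-*ₚ (p *ₚ q) r) (∷-cong refl (*ₚ-assoc p q r))))

  const-*ₚ : ∀ a p → ((a ∷ []) *ₚ p) ≋ (a ·ₚ p)
  const-*ₚ a p = ≋-trans (+ₚ-cong ≋-refl (∷-≋[] refl ≋-refl)) (+ₚ-identityʳ (a ·ₚ p))

  *ₚ-identityˡ : ∀ p → (1ₚ *ₚ p) ≋ p
  *ₚ-identityˡ p = ≋-trans (const-*ₚ 1# p) (·ₚ-identityˡ p)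

  *ₚ-identityʳ : ∀ p → (p *ₚ 1ₚ) ≋ p
  *ₚ-identityʳ p = ≋-trans (*ₚ-comm p 1ₚ) (*ₚ-identityˡ p)

  +ₚ-*ₚ-commutativeRing : CommutativeRing c ℓ
  +ₚ-*ₚ-commutativeRing = record
    { Carrier = Poly ; _≈_ = _≋_ ; _+_ = _+ₚ_ ; _*_ = _*ₚ_ ; -_ = -ₚ_ ; 0# = [] ; 1# = 1ₚ
    ; isCommutativeRing = record
      { isRing = record
        { +-isAbelianGroup = record
          { isGroup = record
            { isMonoid = CommutativeMonoid.isMonoid +ₚ-commutativeMonoid
            ; inverse = -ₚ-inverseˡ , -ₚ-inverseʳ
            ; ⁻¹-cong = -ₚ-cong }
          ; comm = +ₚ-comm }
        ; *-cong = *ₚ-cong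
        ; *-assoc = *ₚ-assoc
        ; *-identity = *ₚ-identityˡ , *ₚ-identityʳ
        ; distrib = *ₚ-distribˡ , λ r p q → *ₚ-distribʳ p q r }
      ; *-comm = *ₚ-comm } }

  module R[X] = CommutativeRing +ₚ-*ₚ-commutativeRing
  open import Algebra.Properties.Semiring.Exp R[X].semiring using (^-congˡ; ^-homo-*; ^-assocʳ)
    renaming (_^_ to _^ᴿ_)
  open import Algebra.Properties.CommutativeSemiring.Exp R[X].commutativeSemiring using (^-distrib-*)
  open import Algebra.Properties.Semiring.Exp semiring using (_^_)
  open import Algebra.Properties.Semiring.Mult semiring using (_×_)
  import Algebra.Properties.Semiring.Mult R[X].semiring as R[X]-Mult
  open import Algebra.Properties.Semiring.Divisibility R[X].semiring public using (_∣_; _,_)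

  ^ₚ≡^ᴿ : ∀ p n → p ^ₚ n ≡ p ^ᴿ n
  ^ₚ≡^ᴿ p zero    = ≡.refl
  ^ₚ≡^ᴿ p (suc n) = ≡.cong (p *ₚ_) (^ₚ≡^ᴿ p n)

  ^ₚ-cong : ∀ {p q} n → p ≋ q → (p ^ₚ n) ≋ (q ^ₚ n)
  ^ₚ-cong {p} {q} n e rewrite ^ₚ≡^ᴿ p n | ^ₚ≡^ᴿ q n = ^-congˡ n e

  ^ₚ-+ : ∀ p m n → (p ^ₚ (m ℕ.+ n)) ≋ ((p ^ₚ m) *ₚ (p ^ₚ n))
  ^ₚ-+ p m n rewrite ^ₚ≡^ᴿ p (m ℕ.+ n) | ^ₚ≡^ᴿ p m | ^ₚ≡^ᴿ p n = ^-homo-* p m n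

  ^ₚ-* : ∀ p m n → ((p ^ₚ m) ^ₚ n) ≋ (p ^ₚ (m ℕ.* n))
  ^ₚ-* p m n rewrite ^ₚ≡^ᴿ (p ^ₚ m) n | ^ₚ≡^ᴿ p m | ^ₚ≡^ᴿ p (m ℕ.* n) = ^-assocʳ p m n

  ^ₚ-distrib-*ₚ : ∀ p q n → ((p *ₚ q) ^ₚ n) ≋ ((p ^ₚ n) *ₚ (q ^ₚ n))
  ^ₚ-distrib-*ₚ p q n rewrite ^ₚ≡^ᴿ (p *ₚ q) n | ^ₚ≡^ᴿ p n | ^ₚ≡^ᴿ q n = ^-distrib-* p q n

  const-^ₚ : ∀ a n → ((a ∷ []) ^ₚ n) ≋ ((a ^ n) ∷ [])
  const-^ₚ a zero    = ≋-refl
  const-^ₚ a (suc n) = ≋-trans (*ₚ-congʳ (a ∷ []) (const-^ₚ a n)) (const-*ₚ a (a ^ n ∷ []))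

  ×1ₚ≋ : ∀ n → R[X]-Mult._×_ n 1ₚ ≋ ((n × 1#) ∷ [])
  ×1ₚ≋ zero    = ≋-sym (∷-≋[] refl ≋-refl)
  ×1ₚ≋ (suc n) = +ₚ-cong ≋-refl (×1ₚ≋ n)

  char-R[X] : ∀ {p} → p × 1# ≈ 0# → R[X]-Mult._×_ p 1ₚ ≋ []
  char-R[X] {p} char-p = ≋-trans (×1ₚ≋ p) (∷-≋[] char-p ≋-refl)

  frobenius-+ₚ : ∀ {p} → Prime p → p × 1# ≈ 0# → ∀ e x y →
    ((x +ₚ y) ^ₚ (p ℕ.^ e)) ≋ ((x ^ₚ (p ℕ.^ e)) +ₚ (y ^ₚ (p ℕ.^ e)))
  frobenius-+ₚ {p} p-prime char-p e x y
    rewrite ^ₚ≡^ᴿ (x +ₚ y) (p ℕ.^ e) | ^ₚ≡^ᴿ x (p ℕ.^ e) | ^ₚ≡^ᴿ y (p ℕ.^ e) =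
    Frobenius.frobenius-^ +ₚ-*ₚ-commutativeRing p-prime (char-R[X] {p} char-p) e x y

  Xₚ-*ₚ : ∀ p → (Xₚ *ₚ p) ≋ (0# ∷ p)
  Xₚ-*ₚ p = ≋-trans (∷-zero-*ₚ (1ₚ) p) (∷-cong refl (*ₚ-identityˡ p))

  coeff-*ₚ-zero : ∀ p q → coeff (p *ₚ q) 0 ≈ coeff p 0 * coeff q 0
  coeff-*ₚ-zero []      q = sym (zeroˡ _)
  coeff-*ₚ-zero (a ∷ p) q = trans (coeff-+ₚ (a ·ₚ q) (0# ∷ (p *ₚ q)) 0) (trans (+-identityʳ _) (coeff-·ₚ a q 0))

  coeff-const-*ₚ : ∀ a p n → coeff ((a ∷ []) *ₚ p) n ≈ a * coeff p n
  coeff-const-*ₚ a p n = trans (coeff-≈ (const-*ₚ a p) n) (coeff-·ₚ a p n)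

  constant+X*tail : ∀ p → p ≋ ((coeff p 0 ∷ []) +ₚ (Xₚ *ₚ drop 1 p))
  constant+X*tail []      = ≋-sym (≋-trans (+ₚ-cong (∷-≋[] refl ≋-refl) (*ₚ-zeroʳ Xₚ)) ≋-refl)
  constant+X*tail (a ∷ p) = ≋-trans (∷≋+ₚ a p) (+ₚ-cong (≋-refl {a ∷ []}) (≋-sym (Xₚ-*ₚ p)))

  coeff-drop : ∀ n p j → coeff (drop n p) j ≡ coeff p (n ℕ.+ j)
  coeff-drop zero    p       j = ≡.refl
  coeff-drop (suc n) []      j = ≡.refl
  coeff-drop (suc n) (a ∷ p) j = coeff-drop n p j

  X^*ₚ≋∷ : ∀ n p → ((Xₚ ^ₚ suc n) *ₚ p) ≋ (0# ∷ ((Xₚ ^ₚ n) *ₚ p))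
  X^*ₚ≋∷ n p = ≋-trans (*ₚ-assoc Xₚ (Xₚ ^ₚ n) p) (Xₚ-*ₚ _)

  coeff-X^*ₚ-< : ∀ n p {j} → j < n → coeff ((Xₚ ^ₚ n) *ₚ p) j ≈ 0#
  coeff-X^*ₚ-< (suc n) p {j} j<n = trans (coeff-≈ (X^*ₚ≋∷ n p) j) (go j j<n)
    where
    go : ∀ j → j < suc n → coeff (0# ∷ ((Xₚ ^ₚ n) *ₚ p)) j ≈ 0#
    go zero    _         = refl
    go (suc j) (s≤s j<n) = coeff-X^*ₚ-< n p j<n

  coeff-X^*ₚ-+ : ∀ n p j → coeff ((Xₚ ^ₚ n) *ₚ p) (n ℕ.+ j) ≈ coeff p j
  coeff-X^*ₚ-+ zero    p j = coeff-≈ (*ₚ-identityˡ p) j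
  coeff-X^*ₚ-+ (suc n) p j =
    trans (coeff-≈ (X^*ₚ≋∷ n p) (suc n ℕ.+ j)) (coeff-X^*ₚ-+ n p j)

  ∣ₚ⇒∣ : ∀ {a b} → a ∣ₚ b → a ∣ b
  ∣ₚ⇒∣ (r , r*a≈b) = r , mk≋ r*a≈b

  ∣⇒∣ₚ : ∀ {a b} → a ∣ b → a ∣ₚ b
  ∣⇒∣ₚ (r , r*a≋b) = r , coeff-≈ r*a≋b

  record Deg≤ (p : Poly) (d : ℕ) : Set ℓ where
    constructor mkDeg≤
    field coeff-> : DegLe p d
  open Deg≤ public

  Deg≤-cong : ∀ {p q d} → p ≋ q → Deg≤ p d → Deg≤ q d
  Deg≤-cong p≋q p≤d = mkDeg≤ λ n d<n → trans (sym (coeff-≈ p≋q n)) (coeff-> p≤d n d<n)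

  Deg≤-mono : ∀ {p d d′} → d ≤ d′ → Deg≤ p d → Deg≤ p d′
  Deg≤-mono d≤d′ p≤d = mkDeg≤ λ n d′<n → coeff-> p≤d n (ℕ.≤-<-trans d≤d′ d′<n)

  Deg≤-≋[] : ∀ {p} d → p ≋ [] → Deg≤ p d
  Deg≤-≋[] d p≋[] = mkDeg≤ λ n _ → coeff-≈ p≋[] n

  Deg≤-const : ∀ a → Deg≤ (a ∷ []) 0
  Deg≤-const a = mkDeg≤ λ where (suc n) _ → refl

  Deg≤-∷ : ∀ {a p d} → Deg≤ p d → Deg≤ (a ∷ p) (suc d)
  Deg≤-∷ p≤d = mkDeg≤ λ where (suc n) (s≤s d<n) → coeff-> p≤d n d<n

  Deg≤-∷⁻¹ : ∀ {a p d} → Deg≤ (a ∷ p) (suc d) → Deg≤ p d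
  Deg≤-∷⁻¹ ap≤d = mkDeg≤ λ n d<n → coeff-> ap≤d (suc n) (s≤s d<n)

  Deg≤0-∷⁻¹ : ∀ {a p} → Deg≤ (a ∷ p) 0 → p ≋ []
  Deg≤0-∷⁻¹ ap≤0 = mk≋ λ n → coeff-> ap≤0 (suc n) (s≤s z≤n)

  Deg≤-+ₚ : ∀ {p q d} → Deg≤ p d → Deg≤ q d → Deg≤ (p +ₚ q) d
  Deg≤-+ₚ {p} {q} p≤d q≤d = mkDeg≤ λ n d<n →
    trans (coeff-+ₚ p q n) (trans (+-cong (coeff-> p≤d n d<n) (coeff-> q≤d n d<n)) (+-identityʳ _))

  Deg≤--ₚ : ∀ {p d} → Deg≤ p d → Deg≤ (-ₚ p) d
  Deg≤--ₚ {p} p≤d = mkDeg≤ λ n d<n → trans (coeff--ₚ p n) (trans (-‿cong (coeff-> p≤d n d<n)) -0#≈0#)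

  Deg≤-·ₚ : ∀ a {p d} → Deg≤ p d → Deg≤ (a ·ₚ p) d
  Deg≤-·ₚ a {p} p≤d = mkDeg≤ λ n d<n → trans (coeff-·ₚ a p n) (trans (*-congˡ (coeff-> p≤d n d<n)) (zeroʳ a))

  Deg≤-*ₚ : ∀ {p q d e} → Deg≤ p d → Deg≤ q e → Deg≤ (p *ₚ q) (d ℕ.+ e)
  Deg≤-*ₚ {[]}             _    _   = mkDeg≤ λ _ _ → refl
  Deg≤-*ₚ {a ∷ p} {q} {zero}  p≤0 q≤e =
    Deg≤-+ₚ (Deg≤-·ₚ a q≤e) (Deg≤-≋[] _ (∷-≋[] refl (*ₚ-zeroˡ q (Deg≤0-∷⁻¹ p≤0))))
  Deg≤-*ₚ {a ∷ p} {q} {suc d} {e} p≤d q≤e =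
    Deg≤-+ₚ (Deg≤-mono (ℕ.m≤n+m e (suc d)) (Deg≤-·ₚ a q≤e)) (Deg≤-∷ (Deg≤-*ₚ (Deg≤-∷⁻¹ p≤d) q≤e))

  coeff-*ₚ-top : ∀ {p q d e} → Deg≤ p d → Deg≤ q e → coeff (p *ₚ q) (d ℕ.+ e) ≈ coeff p d * coeff q e
  coeff-*ₚ-top {[]}                _   _   = sym (zeroˡ _)
  coeff-*ₚ-top {a ∷ p} {q} {zero}  {e} p≤0 q≤e = begin
    coeff ((a ·ₚ q) +ₚ (0# ∷ (p *ₚ q))) e           ≈⟨ coeff-+ₚ (a ·ₚ q) _ e ⟩
    coeff (a ·ₚ q) e + coeff (0# ∷ (p *ₚ q)) e      ≈⟨ +-cong (coeff-·ₚ a q e) p*q≈0 ⟩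
    a * coeff q e + 0#                              ≈⟨ +-identityʳ _ ⟩
    a * coeff q e                                   ∎
    where p*q≈0 = coeff-≈ (∷-≋[] refl (*ₚ-zeroˡ q (Deg≤0-∷⁻¹ p≤0))) e
  coeff-*ₚ-top {a ∷ p} {q} {suc d} {e} p≤d q≤e = begin
    coeff ((a ·ₚ q) +ₚ (0# ∷ (p *ₚ q))) (suc d ℕ.+ e)       ≈⟨ coeff-+ₚ (a ·ₚ q) _ (suc d ℕ.+ e) ⟩
    coeff (a ·ₚ q) (suc d ℕ.+ e) + coeff (p *ₚ q) (d ℕ.+ e)  ≈⟨ +-congʳ (coeff-> (Deg≤-·ₚ a q≤e) _ (ℕ.m<n+m e z<s)) ⟩
    0# + coeff (p *ₚ q) (d ℕ.+ e)                            ≈⟨ +-identityˡ _ ⟩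
    coeff (p *ₚ q) (d ℕ.+ e)                                 ≈⟨ coeff-*ₚ-top (Deg≤-∷⁻¹ p≤d) q≤e ⟩
    coeff p d * coeff q e                                    ∎

  Deg≤-X^*ₚ : ∀ n {p d} → Deg≤ p d → Deg≤ ((Xₚ ^ₚ n) *ₚ p) (n ℕ.+ d)
  Deg≤-X^*ₚ zero    {p} p≤d = Deg≤-cong (≋-sym (*ₚ-identityˡ p)) p≤d
  Deg≤-X^*ₚ (suc n) {p} p≤d = Deg≤-cong (≋-sym (X^*ₚ≋∷ n p)) (Deg≤-∷ (Deg≤-X^*ₚ n p≤d))

  IsUnitₚ-^ₚ : ∀ {G} n → IsUnitₚ G → IsUnitₚ (G ^ₚ n)
  IsUnitₚ-^ₚ {G} n (u , G*u≈1) = u ^ₚ n , coeff-≈ (≋-trans (≋-sym (^ₚ-distrib-*ₚ G u n))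
    (≋-trans (^ₚ-cong n (mk≋ {G *ₚ u} {1ₚ} G*u≈1)) (1ₚ^ₚ n)))
    where
    1ₚ^ₚ : ∀ n → (1ₚ ^ₚ n) ≋ 1ₚ
    1ₚ^ₚ zero    = ≋-refl
    1ₚ^ₚ (suc n) = ≋-trans (*ₚ-identityˡ _) (1ₚ^ₚ n)

  irreducible⇒≉^ₚ : ∀ {H G n} → 1 < n → Irreducible H → ¬ (H ≋ (G ^ₚ n))
  irreducible⇒≉^ₚ {n = suc zero} (s≤s ()) _
  irreducible⇒≉^ₚ {H} {G} {suc (suc k)} _ (_ , H-nonunit , H-irreducible) H≋G^n =
    H-nonunit (H-unit (G-unit (H-irreducible G (G ^ₚ suc k) (coeff-≈ H≋G^n))))
    where
    G-unit : IsUnitₚ G ⊎ IsUnitₚ (G ^ₚ suc k) → IsUnitₚ G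
    G-unit (inj₁ G-unit)             = G-unit
    G-unit (inj₂ (u , G^[k+1]*u≈1)) = (G ^ₚ k) *ₚ u ,
      coeff-≈ (≋-trans (≋-sym (*ₚ-assoc G (G ^ₚ k) u)) (mk≋ {(G ^ₚ suc k) *ₚ u} {1ₚ} G^[k+1]*u≈1))
    H-unit : IsUnitₚ G → IsUnitₚ H
    H-unit G-unit with IsUnitₚ-^ₚ {G} (suc (suc k)) G-unit
    ... | u , G^n*u≈1 = u , coeff-≈ (≋-trans (*ₚ-congˡ u H≋G^n) (mk≋ {(G ^ₚ suc (suc k)) *ₚ u} {1ₚ} G^n*u≈1))

module TruncatedDegree {c ℓ : Level} (R : CommutativeRing c ℓ) (n : ℕ) where
  open CommutativeRing R using (_≈_; _+_; 0#; +-cong; +-identityˡ; setoid)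
  open Polynomial R
  open import Algebra.Solver.Ring.NaturalCoefficients.Default R[X].commutativeSemiring

  Xⁿ : Poly
  Xⁿ = Xₚ ^ₚ n

  record Deg≤Mod (Z : Poly) (d : ℕ) : Set (c ⊔ ℓ) where
    constructor mkDeg≤Mod
    field
      low high : Poly
      low≤d    : Deg≤ low d
      split    : Z ≋ (low +ₚ (Xⁿ *ₚ high))

  Deg≤Mod-cong : ∀ {Z Z′ d} → Z ≋ Z′ → Deg≤Mod Z d → Deg≤Mod Z′ d
  Deg≤Mod-cong Z≋Z′ (mkDeg≤Mod A B A≤d Z≋) = mkDeg≤Mod A B A≤d (≋-trans (≋-sym Z≋Z′) Z≋)

  Deg≤Mod-mono : ∀ {Z d d′} → d ≤ d′ → Deg≤Mod Z d → Deg≤Mod Z d′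
  Deg≤Mod-mono d≤d′ (mkDeg≤Mod A B A≤d Z≋) = mkDeg≤Mod A B (Deg≤-mono d≤d′ A≤d) Z≋

  Deg≤⇒Deg≤Mod : ∀ {Z d} → Deg≤ Z d → Deg≤Mod Z d
  Deg≤⇒Deg≤Mod {Z} Z≤d =
    mkDeg≤Mod Z [] Z≤d (≋-sym (≋-trans (+ₚ-cong (≋-refl {Z}) (*ₚ-zeroʳ Xⁿ)) (+ₚ-identityʳ Z)))

  Deg≤Mod-+ₚ : ∀ {Z W d} → Deg≤Mod Z d → Deg≤Mod W d → Deg≤Mod (Z +ₚ W) d
  Deg≤Mod-+ₚ (mkDeg≤Mod A B A≤d Z≋) (mkDeg≤Mod A′ B′ A′≤d W≋) =
    mkDeg≤Mod (A +ₚ A′) (B +ₚ B′) (Deg≤-+ₚ A≤d A′≤d)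
      (≋-trans (+ₚ-cong Z≋ W≋)
        (solve 5 (λ a b a′ b′ x → (a :+ x :* b) :+ (a′ :+ x :* b′) := (a :+ a′) :+ x :* (b :+ b′))
          ≋-refl A B A′ B′ Xⁿ))

  Deg≤Mod-*ₚ : ∀ {Z W d e} → Deg≤Mod Z d → Deg≤Mod W e → Deg≤Mod (Z *ₚ W) (d ℕ.+ e)
  Deg≤Mod-*ₚ (mkDeg≤Mod A B A≤d Z≋) (mkDeg≤Mod A′ B′ A′≤e W≋) =
    mkDeg≤Mod (A *ₚ A′) (((B *ₚ A′) +ₚ (A *ₚ B′)) +ₚ (Xⁿ *ₚ (B *ₚ B′))) (Deg≤-*ₚ A≤d A′≤e)
      (≋-trans (*ₚ-cong Z≋ W≋)
        (solve 5 (λ a b a′ b′ x → (a :+ x :* b) :* (a′ :+ x :* b′)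
                                 := a :* a′ :+ x :* ((b :* a′ :+ a :* b′) :+ x :* (b :* b′)))
          ≋-refl A B A′ B′ Xⁿ))

  Deg≤Mod-^ₚ : ∀ {Z} i → Deg≤Mod Z 1 → Deg≤Mod (Z ^ₚ i) i
  Deg≤Mod-^ₚ zero    Z≤1 = Deg≤⇒Deg≤Mod (Deg≤-const _)
  Deg≤Mod-^ₚ (suc i) Z≤1 = Deg≤Mod-*ₚ Z≤1 (Deg≤Mod-^ₚ i Z≤1)

  Deg≤Mod⇒coeff≈0 : ∀ {Z d j} → Deg≤Mod Z d → d < j → j < n → coeff Z j ≈ 0#
  Deg≤Mod⇒coeff≈0 {Z} {d} {j} (mkDeg≤Mod A B A≤d Z≋) d<j j<n = begin
    coeff Z j                              ≈⟨ coeff-≈ Z≋ j ⟩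
    coeff (A +ₚ (Xⁿ *ₚ B)) j               ≈⟨ coeff-+ₚ A (Xⁿ *ₚ B) j ⟩
    coeff A j + coeff (Xⁿ *ₚ B) j          ≈⟨ +-cong (coeff-> A≤d j d<j) (coeff-X^*ₚ-< n B j<n) ⟩
    0# + 0#                                ≈⟨ +-identityˡ 0# ⟩
    0#                                     ∎
    where open Reasoning setoid

module Congruence {c ℓ : Level} (R : CommutativeRing c ℓ) where
  open CommutativeRing R
  open import Algebra.Properties.Ring ring using (-0#≈0#; -‿distribˡ-*)
  open import Algebra.Properties.Semiring.Divisibility semiring
    using (_∣_; _,_; _∣0; ∣ʳ-respʳ-≈; x∣ʳyx)
  open import Algebra.Properties.AbelianGroup +-abelianGroup using (⁻¹-anti-homo‿-; ⁻¹-∙-comm)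
  open import Algebra.Properties.CommutativeSemigroup +-commutativeSemigroup using () renaming (interchange to +-interchange)
  open Reasoning setoid

  infix 4 _≡_mod_
  record _≡_mod_ (x y h : Carrier) : Set (c ⊔ ℓ) where
    constructor mk≡mod
    field divides-difference : h ∣ (x - y)
  open _≡_mod_ public

  x-0≈x : ∀ {x} → x - 0# ≈ x
  x-0≈x = trans (+-congˡ -0#≈0#) (+-identityʳ _)

  module _ {h : Carrier} where

    ∣-+ : ∀ {x y} → h ∣ x → h ∣ y → h ∣ (x + y)
    ∣-+ (r , r*h≈x) (s , s*h≈y) = r + s , trans (distribʳ h r s) (+-cong r*h≈x s*h≈y)

    ∣-neg : ∀ {x} → h ∣ x → h ∣ (- x)
    ∣-neg (r , r*h≈x) = - r , trans (sym (-‿distribˡ-* r h)) (-‿cong r*h≈x)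

    ≈⇒≡mod : ∀ {x y} → x ≈ y → x ≡ y mod h
    ≈⇒≡mod {x} {y} x≈y = mk≡mod (∣ʳ-respʳ-≈ (sym (trans (+-congʳ x≈y) (-‿inverseʳ y))) (h ∣0))

    ≡mod-sym : ∀ {x y} → x ≡ y mod h → y ≡ x mod h
    ≡mod-sym {x} {y} (mk≡mod h∣x-y) = mk≡mod (∣ʳ-respʳ-≈ (⁻¹-anti-homo‿- x y) (∣-neg h∣x-y))

    ≡mod-trans : ∀ {x y z} → x ≡ y mod h → y ≡ z mod h → x ≡ z mod h
    ≡mod-trans {x} {y} {z} (mk≡mod h∣x-y) (mk≡mod h∣y-z) = mk≡mod (∣ʳ-respʳ-≈ telescope (∣-+ h∣x-y h∣y-z))
      where
      telescope : (x - y) + (y - z) ≈ x - z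
      telescope = begin
        (x - y) + (y - z)     ≈⟨ +-assoc x (- y) (y - z) ⟩
        x + (- y + (y - z))   ≈⟨ +-congˡ (+-assoc (- y) y (- z)) ⟨
        x + ((- y + y) - z)   ≈⟨ +-congˡ (+-congʳ (-‿inverseˡ y)) ⟩
        x + (0# - z)          ≈⟨ +-congˡ (+-identityˡ (- z)) ⟩
        x - z                 ∎

    ≡mod-+ : ∀ {x y u v} → x ≡ y mod h → u ≡ v mod h → (x + u) ≡ (y + v) mod h
    ≡mod-+ {x} {y} {u} {v} (mk≡mod h∣x-y) (mk≡mod h∣u-v) =
      mk≡mod (∣ʳ-respʳ-≈ (trans (+-interchange x (- y) u (- v)) (+-congˡ (⁻¹-∙-comm y v))) (∣-+ h∣x-y h∣u-v))

    h*≡0 : ∀ z → (h * z) ≡ 0# mod h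
    h*≡0 z = mk≡mod (∣ʳ-respʳ-≈ (trans (*-comm z h) (sym x-0≈x)) (x∣ʳyx h z))

    ≡0⇒∣ : ∀ {x} → x ≡ 0# mod h → h ∣ x
    ≡0⇒∣ (mk≡mod h∣x-0) = ∣ʳ-respʳ-≈ x-0≈x h∣x-0

  ≡mod-setoid : Carrier → Setoid c (c ⊔ ℓ)
  ≡mod-setoid h = record
    { Carrier = Carrier ; _≈_ = λ x y → x ≡ y mod h
    ; isEquivalence = record { refl = ≈⇒≡mod refl ; sym = ≡mod-sym ; trans = ≡mod-trans } }

module PowerCoefficient {c ℓ : Level} (S : CommutativeRing c ℓ) where
  open CommutativeRing S
  open Polynomial S
  open Congruence S
  open import Algebra.Properties.Semiring.Exp semiring using (_^_)
  open import Algebra.Solver.Ring.NaturalCoefficients.Default R[X].commutativeSemiring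

  -- Modulo h the base h + X E is X E, so the n-th coefficient of (X E)ⁿ W is eⁿ w₀.
  coeff-^ₚ*ₚ≡ : ∀ h E n W →
    coeff ((((h ∷ []) +ₚ (Xₚ *ₚ E)) ^ₚ n) *ₚ W) n ≡ (coeff E 0 ^ n) * coeff W 0 mod h
  coeff-^ₚ*ₚ≡ h E zero    W = ≈⇒≡mod (trans (coeff-≈ (*ₚ-identityˡ W) 0) (sym (*-identityˡ _)))
  coeff-^ₚ*ₚ≡ h E (suc n) W = begin
    coeff ((A ^ₚ suc n) *ₚ W) (suc n)                      ≈⟨ ≈⇒≡mod (coeff-≈ expand (suc n)) ⟩
    coeff (((h ∷ []) *ₚ V) +ₚ (Xₚ *ₚ (E *ₚ V))) (suc n)    ≈⟨ ≈⇒≡mod split-coeff ⟩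
    h * coeff V (suc n) + coeff (An *ₚ (E *ₚ W)) n        ≈⟨ ≡mod-+ (h*≡0 _) (≈⇒≡mod refl) ⟩
    0# + coeff (An *ₚ (E *ₚ W)) n                         ≈⟨ ≈⇒≡mod (+-identityˡ _) ⟩
    coeff (An *ₚ (E *ₚ W)) n                              ≈⟨ coeff-^ₚ*ₚ≡ h E n (E *ₚ W) ⟩
    (e ^ n) * coeff (E *ₚ W) 0                            ≈⟨ ≈⇒≡mod (*-congˡ (coeff-*ₚ-zero E W)) ⟩
    (e ^ n) * (e * coeff W 0)                             ≈⟨ ≈⇒≡mod (trans (sym (*-assoc _ _ _)) (*-congʳ (*-comm _ e))) ⟩
    (e ^ suc n) * coeff W 0                               ∎
    where
    open Reasoning (≡mod-setoid h)
    A  = (h ∷ []) +ₚ (Xₚ *ₚ E)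
    An = A ^ₚ n
    V  = An *ₚ W
    e  = coeff E 0
    expand : ((A ^ₚ suc n) *ₚ W) ≋ (((h ∷ []) *ₚ V) +ₚ (Xₚ *ₚ (E *ₚ V)))
    expand = solve 5 (λ h x e an w → ((h :+ x :* e) :* an) :* w := h :* (an :* w) :+ x :* (e :* (an :* w)))
      ≋-refl (h ∷ []) Xₚ E An W
    E*V≋An*E*W : (E *ₚ V) ≋ (An *ₚ (E *ₚ W))
    E*V≋An*E*W = solve 3 (λ e an w → e :* (an :* w) := an :* (e :* w)) ≋-refl E An W
    split-coeff : coeff (((h ∷ []) *ₚ V) +ₚ (Xₚ *ₚ (E *ₚ V))) (suc n) ≈ h * coeff V (suc n) + coeff (An *ₚ (E *ₚ W)) n
    split-coeff = trans (coeff-+ₚ ((h ∷ []) *ₚ V) _ (suc n))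
      (+-cong (coeff-const-*ₚ h V (suc n)) (trans (coeff-≈ (Xₚ-*ₚ (E *ₚ V)) (suc n)) (coeff-≈ E*V≋An*E*W n)))

module Taylor {c ℓ : Level} (R : CommutativeRing c ℓ) where
  open CommutativeRing R hiding (zero)
  open Polynomial R
  open import Algebra.Properties.Semiring.Mult semiring using (_×_; ×-congʳ)
  module Y = Polynomial +ₚ-*ₚ-commutativeRing
  module R[X][Y] = CommutativeRing Y.+ₚ-*ₚ-commutativeRing
  open import Algebra.Properties.CommutativeSemigroup R[X][Y].*-commutativeSemigroup
    using () renaming (x∙yz≈y∙xz to *Y-leftComm)
  open import Algebra.Properties.Group R[X][Y].+-group using (inverseˡ-unique)
  open Congruence +ₚ-*ₚ-commutativeRing using (_≡_mod_; ≈⇒≡mod; ≡mod-setoid)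

  infix 4 _≋Y_
  _≋Y_ : Y.Poly → Y.Poly → Set ℓ
  _≋Y_ = Y._≋_

  ιY : Poly → Y.Poly
  ιY P = P ∷ []

  X+Y : Y.Poly
  X+Y = Xₚ ∷ 1ₚ ∷ []

  -- taylor P = P(X + Y), whose Y-coefficients are the Hasse derivatives of P.
  taylor : Poly → Y.Poly
  taylor []      = []
  taylor (a ∷ P) = ιY (a ∷ []) Y.+ₚ (X+Y Y.*ₚ taylor P)

  ιY-const-cong : ∀ {a b} → a ≈ b → ιY (a ∷ []) ≋Y ιY (b ∷ [])
  ιY-const-cong a≈b = Y.∷-cong (∷-cong a≈b ≋-refl) Y.≋-refl

  ιY-≋[] : ∀ {P} → P ≋ [] → ιY P ≋Y []
  ιY-≋[] P≋[] = Y.∷-≋[] P≋[] Y.≋-refl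

  taylor-≋[] : ∀ {P} → P ≋ [] → taylor P ≋Y []
  taylor-≋[] {[]}    _    = Y.≋-refl
  taylor-≋[] {a ∷ P} P≋[] = Y.≋-trans
    (Y.+ₚ-cong (ιY-≋[] (∷-≋[] (coeff-≈ P≋[] 0) ≋-refl))
               (Y.≋-trans (Y.*ₚ-congʳ X+Y (taylor-≋[] (∷≋[]⇒≋[] P≋[]))) (Y.*ₚ-zeroʳ X+Y)))
    Y.≋-refl

  taylor-cong : ∀ {P Q} → P ≋ Q → taylor P ≋Y taylor Q
  taylor-cong {[]}    {Q}     P≋Q = Y.≋-sym (taylor-≋[] (≋-sym P≋Q))
  taylor-cong {a ∷ P} {[]}    P≋Q = taylor-≋[] P≋Q
  taylor-cong {a ∷ P} {b ∷ Q} P≋Q =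
    Y.+ₚ-cong (ιY-const-cong (coeff-≈ P≋Q 0)) (Y.*ₚ-congʳ X+Y (taylor-cong (∷-injectiveʳ P≋Q)))

  taylor-+ₚ : ∀ P Q → taylor (P +ₚ Q) ≋Y (taylor P Y.+ₚ taylor Q)
  taylor-+ₚ []      Q       = Y.≋-refl
  taylor-+ₚ (a ∷ P) []      = Y.≋-sym (Y.+ₚ-identityʳ _)
  taylor-+ₚ (a ∷ P) (b ∷ Q) = Y.≋-trans
    (Y.+ₚ-cong (Y.≋-refl {ιY ((a + b) ∷ [])})
               (Y.≋-trans (Y.*ₚ-congʳ X+Y (taylor-+ₚ P Q)) (Y.*ₚ-distribˡ X+Y (taylor P) (taylor Q))))
    (Y.+ₚ-interchange (ιY (a ∷ [])) (ιY (b ∷ [])) (X+Y Y.*ₚ taylor P) (X+Y Y.*ₚ taylor Q))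

  ιY-const-*ₚ : ∀ a b → (ιY (a ∷ []) Y.*ₚ ιY (b ∷ [])) ≋Y ιY ((a * b) ∷ [])
  ιY-const-*ₚ a b = Y.≋-trans (Y.const-*ₚ (a ∷ []) (ιY (b ∷ []))) (Y.∷-cong (const-*ₚ a (b ∷ [])) Y.≋-refl)

  taylor-·ₚ : ∀ a Q → taylor (a ·ₚ Q) ≋Y (ιY (a ∷ []) Y.*ₚ taylor Q)
  taylor-·ₚ a []      = Y.≋-sym (Y.*ₚ-zeroʳ (ιY (a ∷ [])))
  taylor-·ₚ a (b ∷ Q) = begin
    ιY ((a * b) ∷ []) Y.+ₚ (X+Y Y.*ₚ taylor (a ·ₚ Q))
      ≈⟨ Y.+ₚ-cong (Y.≋-sym (ιY-const-*ₚ a b)) (Y.*ₚ-congʳ X+Y (taylor-·ₚ a Q)) ⟩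
    (a′ Y.*ₚ ιY (b ∷ [])) Y.+ₚ (X+Y Y.*ₚ (a′ Y.*ₚ taylor Q))
      ≈⟨ Y.+ₚ-cong (Y.≋-refl {a′ Y.*ₚ ιY (b ∷ [])}) (*Y-leftComm X+Y a′ (taylor Q)) ⟩
    (a′ Y.*ₚ ιY (b ∷ [])) Y.+ₚ (a′ Y.*ₚ (X+Y Y.*ₚ taylor Q))
      ≈⟨ R[X][Y].distribˡ a′ (ιY (b ∷ [])) (X+Y Y.*ₚ taylor Q) ⟨
    a′ Y.*ₚ taylor (b ∷ Q) ∎
    where
    open Reasoning Y.≋-setoid
    a′ = ιY (a ∷ [])

  taylor-*ₚ : ∀ P Q → taylor (P *ₚ Q) ≋Y (taylor P Y.*ₚ taylor Q)
  taylor-*ₚ []      Q = Y.≋-refl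
  taylor-*ₚ (a ∷ P) Q = begin
    taylor ((a ·ₚ Q) +ₚ (0# ∷ (P *ₚ Q)))
      ≈⟨ taylor-+ₚ (a ·ₚ Q) (0# ∷ (P *ₚ Q)) ⟩
    taylor (a ·ₚ Q) Y.+ₚ taylor (0# ∷ (P *ₚ Q))
      ≈⟨ Y.+ₚ-cong (taylor-·ₚ a Q) taylor-X*ₚ ⟩
    (ιY (a ∷ []) Y.*ₚ taylor Q) Y.+ₚ ((X+Y Y.*ₚ taylor P) Y.*ₚ taylor Q)
      ≈⟨ R[X][Y].distribʳ (taylor Q) (ιY (a ∷ [])) (X+Y Y.*ₚ taylor P) ⟨
    taylor (a ∷ P) Y.*ₚ taylor Q ∎
    where
    open Reasoning Y.≋-setoid
    taylor-X*ₚ : taylor (0# ∷ (P *ₚ Q)) ≋Y ((X+Y Y.*ₚ taylor P) Y.*ₚ taylor Q)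
    taylor-X*ₚ = Y.≋-trans (Y.+ₚ-cong (ιY-≋[] (∷-≋[] refl ≋-refl)) (Y.*ₚ-congʳ X+Y (taylor-*ₚ P Q)))
                           (R[X][Y].sym (R[X][Y].*-assoc X+Y (taylor P) (taylor Q)))

  taylor-1ₚ : taylor 1ₚ ≋Y Y.1ₚ
  taylor-1ₚ = Y.≋-trans (Y.+ₚ-cong (Y.≋-refl {ιY 1ₚ}) (Y.*ₚ-zeroʳ X+Y)) (Y.+ₚ-identityʳ _)

  taylor-Xₚ : taylor Xₚ ≋Y X+Y
  taylor-Xₚ = Y.≋-trans
    (Y.+ₚ-cong (ιY-≋[] (∷-≋[] refl ≋-refl)) (Y.≋-trans (Y.*ₚ-congʳ X+Y taylor-1ₚ) (R[X][Y].*-identityʳ X+Y)))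
    Y.≋-refl

  taylor-^ₚ : ∀ P n → taylor (P ^ₚ n) ≋Y (taylor P Y.^ₚ n)
  taylor-^ₚ P zero    = taylor-1ₚ
  taylor-^ₚ P (suc n) = Y.≋-trans (taylor-*ₚ P (P ^ₚ n)) (Y.*ₚ-congʳ (taylor P) (taylor-^ₚ P n))

  taylor--ₚ : ∀ P → taylor (-ₚ P) ≋Y (Y.-ₚ taylor P)
  taylor--ₚ P = inverseˡ-unique (taylor (-ₚ P)) (taylor P)
    (Y.≋-trans (Y.≋-sym (taylor-+ₚ (-ₚ P) P)) (taylor-≋[] (-ₚ-inverseˡ P)))

  coeff-taylor-0 : ∀ P → Y.coeff (taylor P) 0 ≋ P
  coeff-taylor-0 []      = ≋-refl
  coeff-taylor-0 (a ∷ P) = begin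
    Y.coeff (ιY (a ∷ []) Y.+ₚ (X+Y Y.*ₚ taylor P)) 0
      ≈⟨ Y.coeff-+ₚ (ιY (a ∷ [])) (X+Y Y.*ₚ taylor P) 0 ⟩
    (a ∷ []) +ₚ Y.coeff (X+Y Y.*ₚ taylor P) 0
      ≈⟨ +ₚ-cong (≋-refl {a ∷ []}) (Y.coeff-*ₚ-zero X+Y (taylor P)) ⟩
    (a ∷ []) +ₚ (Xₚ *ₚ Y.coeff (taylor P) 0)
      ≈⟨ +ₚ-cong (≋-refl {a ∷ []}) (≋-trans (*ₚ-congʳ Xₚ (coeff-taylor-0 P)) (Xₚ-*ₚ P)) ⟩
    (a ∷ []) +ₚ (0# ∷ P)
      ≈⟨ ∷≋+ₚ a P ⟨
    a ∷ P ∎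
    where open Reasoning ≋-setoid

  taylor≋ιY+Y* : ∀ P → taylor P ≋Y (ιY P Y.+ₚ (Y.Xₚ Y.*ₚ drop 1 (taylor P)))
  taylor≋ιY+Y* P = Y.≋-trans (Y.constant+X*tail (taylor P))
    (Y.+ₚ-cong (Y.∷-cong (coeff-taylor-0 P) Y.≋-refl) (Y.≋-refl {Y.Xₚ Y.*ₚ drop 1 (taylor P)}))

  Deg≤-taylor : ∀ {P d} → Deg≤ P d → Y.Deg≤ (taylor P) d
  Deg≤-taylor {[]}            _   = Y.Deg≤-≋[] _ Y.≋-refl
  Deg≤-taylor {a ∷ P} {zero}  P≤0 =
    Y.Deg≤-+ₚ (Y.Deg≤-const _)
      (Y.Deg≤-≋[] 0 (Y.≋-trans (Y.*ₚ-congʳ X+Y (taylor-≋[] (Deg≤0-∷⁻¹ P≤0))) (Y.*ₚ-zeroʳ X+Y)))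
  Deg≤-taylor {a ∷ P} {suc d} P≤d =
    Y.Deg≤-+ₚ (Y.Deg≤-mono z≤n (Y.Deg≤-const _)) (Y.Deg≤-*ₚ Deg≤-X+Y (Deg≤-taylor (Deg≤-∷⁻¹ P≤d)))
    where
    Deg≤-X+Y : Y.Deg≤ X+Y 1
    Deg≤-X+Y = Y.Deg≤-∷ (Y.Deg≤-const 1ₚ)

  derivative : Poly → Poly
  derivative P = Y.coeff (taylor P) 1

  derivative-∷ : ∀ a P → derivative (a ∷ P) ≋ (P +ₚ (Xₚ *ₚ derivative P))
  derivative-∷ a P = begin
    Y.coeff (ιY (a ∷ []) Y.+ₚ (X+Y Y.*ₚ taylor P)) 1
      ≈⟨ Y.coeff-+ₚ (ιY (a ∷ [])) (X+Y Y.*ₚ taylor P) 1 ⟩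
    Y.coeff ((Xₚ Y.·ₚ taylor P) Y.+ₚ (R[X].0# ∷ (ιY 1ₚ Y.*ₚ taylor P))) 1
      ≈⟨ Y.coeff-+ₚ (Xₚ Y.·ₚ taylor P) _ 1 ⟩
    Y.coeff (Xₚ Y.·ₚ taylor P) 1 +ₚ Y.coeff (ιY 1ₚ Y.*ₚ taylor P) 0
      ≈⟨ +ₚ-cong (Y.coeff-·ₚ Xₚ (taylor P) 1) (Y.coeff-const-*ₚ 1ₚ (taylor P) 0) ⟩
    (Xₚ *ₚ derivative P) +ₚ (1ₚ *ₚ Y.coeff (taylor P) 0)
      ≈⟨ +ₚ-cong (≋-refl {Xₚ *ₚ derivative P}) (≋-trans (*ₚ-identityˡ _) (coeff-taylor-0 P)) ⟩
    (Xₚ *ₚ derivative P) +ₚ P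
      ≈⟨ +ₚ-comm _ P ⟩
    P +ₚ (Xₚ *ₚ derivative P) ∎
    where open Reasoning ≋-setoid

  private
    ×-zeroʳ : ∀ n → n × 0# ≈ 0#
    ×-zeroʳ zero    = refl
    ×-zeroʳ (suc n) = trans (+-identityˡ _) (×-zeroʳ n)

  coeff-derivative : ∀ P n → coeff (derivative P) n ≈ suc n × coeff P (suc n)
  coeff-derivative []      n = sym (×-zeroʳ (suc n))
  coeff-derivative (a ∷ P) n = begin
    coeff (derivative (a ∷ P)) n              ≈⟨ coeff-≈ (derivative-∷ a P) n ⟩
    coeff (P +ₚ (Xₚ *ₚ derivative P)) n       ≈⟨ coeff-+ₚ P _ n ⟩
    coeff P n + coeff (Xₚ *ₚ derivative P) n  ≈⟨ +-congˡ (coeff-≈ (Xₚ-*ₚ (derivative P)) n) ⟩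
    coeff P n + coeff (0# ∷ derivative P) n   ≈⟨ +-congˡ (lower n) ⟩
    coeff P n + n × coeff P n                 ∎
    where
    open Reasoning setoid
    lower : ∀ n → coeff (0# ∷ derivative P) n ≈ n × coeff P n
    lower zero    = refl
    lower (suc n) = coeff-derivative P n

  coeff-derivative-≈0 : ∀ P n → coeff P (suc n) ≈ 0# → coeff (derivative P) n ≈ 0#
  coeff-derivative-≈0 P n P≈0 = trans (coeff-derivative P n) (trans (×-congʳ (suc n) P≈0) (×-zeroʳ (suc n)))

  coeff-taylor-^ₚ*ₚ≡ : ∀ H m W → Y.coeff (taylor ((H ^ₚ m) *ₚ W)) m ≡ (derivative H ^ₚ m) *ₚ W mod H
  coeff-taylor-^ₚ*ₚ≡ H m W = begin
    Y.coeff (taylor ((H ^ₚ m) *ₚ W)) m            ≈⟨ ≈⇒≡mod (Y.coeff-≈ taylor-H^*W m) ⟩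
    Y.coeff ((A Y.^ₚ m) Y.*ₚ taylor W) m          ≈⟨ PowerCoefficient.coeff-^ₚ*ₚ≡ +ₚ-*ₚ-commutativeRing H E m (taylor W) ⟩
    (Y.coeff E 0 ^ᴿ m) *ₚ Y.coeff (taylor W) 0    ≈⟨ ≈⇒≡mod (*ₚ-cong (≋-reflexive E₀^m≡D^m) (coeff-taylor-0 W)) ⟩
    (derivative H ^ₚ m) *ₚ W                      ∎
    where
    open Reasoning (≡mod-setoid H)
    open import Algebra.Properties.Semiring.Exp R[X].semiring using () renaming (_^_ to _^ᴿ_)
    E = drop 1 (taylor H)
    A = ιY H Y.+ₚ (Y.Xₚ Y.*ₚ E)
    taylor-H^*W : taylor ((H ^ₚ m) *ₚ W) ≋Y ((A Y.^ₚ m) Y.*ₚ taylor W)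
    taylor-H^*W = Y.≋-trans (taylor-*ₚ (H ^ₚ m) W)
      (Y.*ₚ-congˡ (taylor W) (Y.≋-trans (taylor-^ₚ H m) (Y.^ₚ-cong m (taylor≋ιY+Y* H))))
    E₀^m≡D^m : Y.coeff E 0 ^ᴿ m ≡ derivative H ^ₚ m
    E₀^m≡D^m = ≡.trans (≡.cong (_^ᴿ m) (Y.coeff-drop 1 (taylor H) 0)) (≡.sym (^ₚ≡^ᴿ (derivative H) m))

module TaylorCharP {c ℓ : Level} (R : CommutativeRing c ℓ) {p : ℕ} (p-prime : Prime p) (e : ℕ) where
  open CommutativeRing R using (_≈_; 0#; 1#)
  open Polynomial R
  open Taylor R
  open import Algebra.Properties.Semiring.Mult (CommutativeRing.semiring R) using (_×_)
  open import Algebra.Solver.Ring.NaturalCoefficients.Default R[X][Y].commutativeSemiring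

  q : ℕ
  q = p ℕ.^ e

  open TruncatedDegree +ₚ-*ₚ-commutativeRing q public

  ιY-^ₚ : ∀ P n → (ιY P Y.^ₚ n) ≋Y ιY (P ^ₚ n)
  ιY-^ₚ P n = Y.≋-trans (Y.const-^ₚ P n) (Y.≋-reflexive (≡.cong ιY (≡.sym (^ₚ≡^ᴿ P n))))

  Deg≤Mod-taylor-sumₚ : ∀ {d} n (f : Fin n → Poly) → (∀ i → Deg≤Mod (taylor (f i)) d) →
    Deg≤Mod (taylor (sumₚ n f)) d
  Deg≤Mod-taylor-sumₚ zero    f _     = Deg≤⇒Deg≤Mod (Y.Deg≤-≋[] _ Y.≋-refl)
  Deg≤Mod-taylor-sumₚ (suc n) f f-low = Deg≤Mod-cong (Y.≋-sym (taylor-+ₚ (f fzero) (sumₚ n (λ i → f (fsuc i)))))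
    (Deg≤Mod-+ₚ (f-low fzero) (Deg≤Mod-taylor-sumₚ n (λ i → f (fsuc i)) (λ i → f-low (fsuc i))))

  module _ (char-p : p × 1# ≈ 0#) where

    frobenius-Y : ∀ x y → ((x Y.+ₚ y) Y.^ₚ q) ≋Y ((x Y.^ₚ q) Y.+ₚ (y Y.^ₚ q))
    frobenius-Y = Y.frobenius-+ₚ p-prime (char-R[X] {p} char-p) e

    taylor-^q : ∀ G → taylor (G ^ₚ q) ≋Y (ιY (G ^ₚ q) Y.+ₚ (Xⁿ Y.*ₚ (drop 1 (taylor G) Y.^ₚ q)))
    taylor-^q G = begin
      taylor (G ^ₚ q)                                          ≈⟨ taylor-^ₚ G q ⟩
      taylor G Y.^ₚ q                                          ≈⟨ Y.^ₚ-cong q (taylor≋ιY+Y* G) ⟩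
      (ιY G Y.+ₚ (Y.Xₚ Y.*ₚ E)) Y.^ₚ q                          ≈⟨ frobenius-Y (ιY G) (Y.Xₚ Y.*ₚ E) ⟩
      (ιY G Y.^ₚ q) Y.+ₚ ((Y.Xₚ Y.*ₚ E) Y.^ₚ q)                 ≈⟨ Y.+ₚ-cong (ιY-^ₚ G q) (Y.^ₚ-distrib-*ₚ Y.Xₚ E q) ⟩
      ιY (G ^ₚ q) Y.+ₚ (Xⁿ Y.*ₚ (E Y.^ₚ q))                     ∎
      where
      open Reasoning Y.≋-setoid
      E = drop 1 (taylor G)

    coeff-taylor-^q*ₚ : ∀ G S {j} → j < q →
      Y.coeff (taylor ((G ^ₚ q) *ₚ S)) j ≋ ((G ^ₚ q) *ₚ Y.coeff (taylor S) j)
    coeff-taylor-^q*ₚ G S {j} j<q = begin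
      Y.coeff (taylor (Gq *ₚ S)) j
        ≈⟨ Y.coeff-≈ split j ⟩
      Y.coeff ((ιY Gq Y.*ₚ taylor S) Y.+ₚ (Xⁿ Y.*ₚ B)) j
        ≈⟨ Y.coeff-+ₚ (ιY Gq Y.*ₚ taylor S) (Xⁿ Y.*ₚ B) j ⟩
      (Y.coeff (ιY Gq Y.*ₚ taylor S) j) +ₚ Y.coeff (Xⁿ Y.*ₚ B) j
        ≈⟨ +ₚ-cong (Y.coeff-const-*ₚ Gq (taylor S) j) (Y.coeff-X^*ₚ-< q B j<q) ⟩
      (Gq *ₚ Y.coeff (taylor S) j) +ₚ []
        ≈⟨ +ₚ-identityʳ _ ⟩
      Gq *ₚ Y.coeff (taylor S) j ∎
      where
      open Reasoning ≋-setoid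
      Gq = G ^ₚ q
      B = (drop 1 (taylor G) Y.^ₚ q) Y.*ₚ taylor S
      split : taylor (Gq *ₚ S) ≋Y ((ιY Gq Y.*ₚ taylor S) Y.+ₚ (Xⁿ Y.*ₚ B))
      split = Y.≋-trans (taylor-*ₚ Gq S) (Y.≋-trans (Y.*ₚ-congˡ (taylor S) (taylor-^q G))
        (solve 4 (λ g x e s → (g :+ x :* e) :* s := g :* s :+ x :* (e :* s)) Y.≋-refl
          (ιY Gq) Xⁿ (drop 1 (taylor G) Y.^ₚ q) (taylor S)))

    Deg≤Mod-taylor-Λ : Deg≤Mod (taylor (Λ q)) 1
    Deg≤Mod-taylor-Λ = Deg≤Mod-cong (Y.≋-sym taylor-Λ) (mkDeg≤Mod low Y.1ₚ low≤1 Y.≋-refl)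
      where
      low = ιY (Xₚ ^ₚ q) Y.+ₚ (Y.-ₚ X+Y)
      low≤1 : Y.Deg≤ low 1
      low≤1 = Y.Deg≤-+ₚ {ιY (Xₚ ^ₚ q)} {Y.-ₚ X+Y}
        (Y.Deg≤-mono z≤n (Y.Deg≤-const _)) (Y.Deg≤--ₚ (Y.Deg≤-∷ (Y.Deg≤-const 1ₚ)))
      taylor-Λ : taylor (Λ q) ≋Y (low Y.+ₚ (Xⁿ Y.*ₚ Y.1ₚ))
      taylor-Λ = begin
        taylor ((Xₚ ^ₚ q) +ₚ (-ₚ Xₚ))
          ≈⟨ taylor-+ₚ (Xₚ ^ₚ q) (-ₚ Xₚ) ⟩
        taylor (Xₚ ^ₚ q) Y.+ₚ taylor (-ₚ Xₚ)
          ≈⟨ Y.+ₚ-cong (taylor-^ₚ Xₚ q) (taylor--ₚ Xₚ) ⟩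
        (taylor Xₚ Y.^ₚ q) Y.+ₚ (Y.-ₚ taylor Xₚ)
          ≈⟨ Y.+ₚ-cong (Y.^ₚ-cong q taylor-Xₚ) (Y.-ₚ-cong taylor-Xₚ) ⟩
        ((ιY Xₚ Y.+ₚ Y.Xₚ) Y.^ₚ q) Y.+ₚ (Y.-ₚ X+Y)
          ≈⟨ Y.+ₚ-cong (frobenius-Y (ιY Xₚ) Y.Xₚ) (Y.≋-refl {Y.-ₚ X+Y}) ⟩
        ((ιY Xₚ Y.^ₚ q) Y.+ₚ Xⁿ) Y.+ₚ (Y.-ₚ X+Y)
          ≈⟨ Y.+ₚ-cong (Y.+ₚ-cong (ιY-^ₚ Xₚ q) (Y.≋-refl {Xⁿ})) (Y.≋-refl {Y.-ₚ X+Y}) ⟩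
        (ιY (Xₚ ^ₚ q) Y.+ₚ Xⁿ) Y.+ₚ (Y.-ₚ X+Y)
          ≈⟨ solve 3 (λ a y n → (a :+ y) :+ n := (a :+ n) :+ y :* con 1) Y.≋-refl (ιY (Xₚ ^ₚ q)) Xⁿ (Y.-ₚ X+Y) ⟩
        low Y.+ₚ (Xⁿ Y.*ₚ Y.1ₚ) ∎
        where open Reasoning Y.≋-setoid

    Deg≤Mod-taylor-Λ-combination : ∀ k t (Cs : Fin t → Poly) → (∀ i → DegLe (Cs i) k) →
      Deg≤Mod (taylor (sumₚ t (λ i → Cs i *ₚ (Λ q ^ₚ toℕ i)))) (k ℕ.+ t ∸ 1)
    Deg≤Mod-taylor-Λ-combination k t Cs Cs≤k = Deg≤Mod-taylor-sumₚ t _ term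
      where
      term : ∀ i → Deg≤Mod (taylor (Cs i *ₚ (Λ q ^ₚ toℕ i))) (k ℕ.+ t ∸ 1)
      term i = Deg≤Mod-cong (Y.≋-sym taylor-term) (Deg≤Mod-mono (ℕ.<⇒≤pred (ℕ.+-monoʳ-< k (toℕ<n i)))
        (Deg≤Mod-*ₚ (Deg≤⇒Deg≤Mod (Deg≤-taylor {Cs i} (mkDeg≤ (Cs≤k i)))) (Deg≤Mod-^ₚ (toℕ i) Deg≤Mod-taylor-Λ)))
        where
        taylor-term : taylor (Cs i *ₚ (Λ q ^ₚ toℕ i)) ≋Y (taylor (Cs i) Y.*ₚ (taylor (Λ q) Y.^ₚ toℕ i))
        taylor-term = Y.≋-trans (taylor-*ₚ (Cs i) _) (Y.*ₚ-congʳ (taylor (Cs i)) (taylor-^ₚ (Λ q) (toℕ i)))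

module Field {c ℓ : Level} (F : CommutativeRing c ℓ) (isField : IsField F) where
  open CommutativeRing F
  open Reasoning setoid

  1≉0 : ¬ (1# ≈ 0#)
  1≉0 = proj₁ isField

  x*y≈0⇒y≈0 : ∀ {x y} → ¬ (x ≈ 0#) → x * y ≈ 0# → y ≈ 0#
  x*y≈0⇒y≈0 {x} {y} x≉0 xy≈0 with proj₂ isField x x≉0
  ... | x⁻¹ , x*x⁻¹≈1 = begin
    y                 ≈⟨ *-identityˡ y ⟨
    1# * y            ≈⟨ *-congʳ x*x⁻¹≈1 ⟨
    (x * x⁻¹) * y     ≈⟨ *-congʳ (*-comm x x⁻¹) ⟩
    (x⁻¹ * x) * y     ≈⟨ *-assoc x⁻¹ x y ⟩
    x⁻¹ * (x * y)     ≈⟨ *-congˡ xy≈0 ⟩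
    x⁻¹ * 0#          ≈⟨ zeroʳ x⁻¹ ⟩
    0#                ∎

  *-≉0 : ∀ {x y} → ¬ (x ≈ 0#) → ¬ (y ≈ 0#) → ¬ (x * y ≈ 0#)
  *-≉0 x≉0 y≉0 xy≈0 = y≉0 (x*y≈0⇒y≈0 x≉0 xy≈0)

Fin-injective⇒surjective : ∀ {n} (f : Fin n → Fin n) → (∀ {x y} → f x ≡ f y → x ≡ y) → ∀ y → ∃ λ x → f x ≡ y
Fin-injective⇒surjective f f-inj y with Fin.any? (λ i → f i Fin.≟ y)
... | yes hit = hit
Fin-injective⇒surjective {suc n} f f-inj y | no miss =
  ⊥-elim (ℕ.<-irrefl ≡.refl (Fin.injective⇒≤ {f = f′} f′-inj))
  where
  f′ : Fin (suc n) → Fin n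
  f′ i = Fin.punchOut {i = y} (λ y≡fi → miss (i , ≡.sym y≡fi))
  f′-inj : ∀ {a b} → f′ a ≡ f′ b → a ≡ b
  f′-inj {a} {b} eq = f-inj (Fin.punchOut-injective {i = y} (λ e → miss (a , ≡.sym e)) (λ e → miss (b , ≡.sym e)) eq)

module FiniteField {c ℓ : Level} (F : CommutativeRing c ℓ) (isField : IsField F) {q : ℕ} (card : HasCardinality F q) where
  open CommutativeRing F hiding (zero)
  open Field F isField
  open import Algebra.Properties.Semiring.Mult semiring using (_×_; ×1-homo-*)
  open import Algebra.Properties.Semiring.Exp semiring using (_^_; ^-congˡ)
  open import Algebra.Properties.CommutativeMonoid.Sum +-commutativeMonoid
    using (sum; sum-permute; sum-cong-≋; ∑-distrib-+; sum-replicate)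
  open import Algebra.Properties.Group +-group using (∙-cancelʳ; x∙y⁻¹≈ε⇒x≈y)
  open Reasoning setoid

  private
    enum : Fin q → Carrier
    enum = proj₁ card

    enum-injective : ∀ i j → enum i ≈ enum j → i ≡ j
    enum-injective = proj₁ (proj₂ card)

    index : Carrier → Fin q
    index x = proj₁ (proj₂ (proj₂ card) x)

    enum-index : ∀ x → enum (index x) ≈ x
    enum-index x = proj₂ (proj₂ (proj₂ card) x)

  _≟_ : ∀ x y → Dec (x ≈ y)
  x ≟ y with index x Fin.≟ index y
  ... | yes ix≡iy = yes (trans (sym (enum-index x)) (trans (reflexive (≡.cong enum ix≡iy)) (enum-index y)))
  ... | no  ix≢iy = no λ x≈y → ix≢iy (enum-injective _ _ (trans (enum-index x) (trans x≈y (sym (enum-index y)))))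

  ^≈0⇒≈0 : ∀ x n → x ^ n ≈ 0# → x ≈ 0#
  ^≈0⇒≈0 x zero    1≈0 = ⊥-elim (1≉0 1≈0)
  ^≈0⇒≈0 x (suc n) x^n+1≈0 with x ≟ 0#
  ... | yes x≈0 = x≈0
  ... | no  x≉0 = ^≈0⇒≈0 x n (x*y≈0⇒y≈0 x≉0 x^n+1≈0)

  -- Translation by 1 permutes F, so Σ x = Σ (x + 1) = Σ x + q·1.
  q×1≈0 : q × 1# ≈ 0#
  q×1≈0 = ∙-cancelʳ Σ (q × 1#) 0# (begin
    q × 1# + Σ      ≈⟨ +-comm _ Σ ⟩
    Σ + q × 1#      ≈⟨ Σ≈Σ+q×1 ⟨
    Σ               ≈⟨ +-identityˡ Σ ⟨
    0# + Σ          ∎)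
    where
    shift : Fin q → Fin q
    shift i = index (enum i + 1#)
    unshift : Fin q → Fin q
    unshift i = index (enum i - 1#)
    shift-unshift : ∀ i → shift (unshift i) ≡ i
    shift-unshift i = enum-injective _ _ (begin
      enum (shift (unshift i))   ≈⟨ enum-index _ ⟩
      enum (unshift i) + 1#      ≈⟨ +-congʳ (enum-index _) ⟩
      (enum i - 1#) + 1#         ≈⟨ +-assoc _ _ _ ⟩
      enum i + (- 1# + 1#)       ≈⟨ +-congˡ (-‿inverseˡ 1#) ⟩
      enum i + 0#                ≈⟨ +-identityʳ _ ⟩
      enum i                     ∎)
    unshift-shift : ∀ i → unshift (shift i) ≡ i
    unshift-shift i = enum-injective _ _ (begin
      enum (unshift (shift i))   ≈⟨ enum-index _ ⟩
      enum (shift i) - 1#        ≈⟨ +-congʳ (enum-index _) ⟩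
      (enum i + 1#) - 1#         ≈⟨ +-assoc _ _ _ ⟩
      enum i + (1# - 1#)         ≈⟨ +-congˡ (-‿inverseʳ 1#) ⟩
      enum i + 0#                ≈⟨ +-identityʳ _ ⟩
      enum i                     ∎)
    Σ = sum enum
    Σ≈Σ+q×1 : Σ ≈ Σ + q × 1#
    Σ≈Σ+q×1 = begin
      Σ                                ≈⟨ sum-permute enum (permutation shift unshift shift-unshift unshift-shift) ⟩
      sum (λ i → enum (shift i))       ≈⟨ sum-cong-≋ {q} (λ i → enum-index (enum i + 1#)) ⟩
      sum (λ i → enum i + 1#)          ≈⟨ ∑-distrib-+ {q} enum (λ _ → 1#) ⟩
      Σ + sum {q} (λ _ → 1#)           ≈⟨ +-congˡ (sum-replicate q) ⟩
      Σ + q × 1#                       ∎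

  module Characteristic {p e : ℕ} (p-prime : Prime p) (q≡p^e : q ≡ p ℕ.^ e) where

    p×1≈0 : p × 1# ≈ 0#
    p×1≈0 = ^≈0⇒≈0 (p × 1#) e (begin
      (p × 1#) ^ e    ≈⟨ ×1-^ e ⟨
      (p ℕ.^ e) × 1#  ≡⟨ ≡.cong (_× 1#) q≡p^e ⟨
      q × 1#          ≈⟨ q×1≈0 ⟩
      0#              ∎)
      where
      ×1-^ : ∀ e → (p ℕ.^ e) × 1# ≈ (p × 1#) ^ e
      ×1-^ zero    = +-identityʳ 1#
      ×1-^ (suc e) = trans (×1-homo-* p (p ℕ.^ e)) (*-congˡ (×1-^ e))

    frobenius-injective : ∀ {x y} → x ^ p ≈ y ^ p → x ≈ y
    frobenius-injective {x} {y} x^p≈y^p = x∙y⁻¹≈ε⇒x≈y x y (^≈0⇒≈0 (x - y) p (∙-cancelʳ (y ^ p) _ _ (begin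
      (x - y) ^ p + y ^ p   ≈⟨ Frobenius.frobenius F p-prime p×1≈0 (x - y) y ⟨
      ((x - y) + y) ^ p     ≈⟨ ^-congˡ p x-y+y≈x ⟩
      x ^ p                 ≈⟨ x^p≈y^p ⟩
      y ^ p                 ≈⟨ +-identityˡ _ ⟨
      0# + y ^ p            ∎)))
      where
      x-y+y≈x : (x - y) + y ≈ x
      x-y+y≈x = trans (+-assoc x (- y) y) (trans (+-congˡ (-‿inverseˡ y)) (+-identityʳ x))

    private
      frob : Fin q → Fin q
      frob i = index (enum i ^ p)

      frob-surjective : ∀ j → ∃ λ i → frob i ≡ j
      frob-surjective = Fin-injective⇒surjective frob λ {i} {j} eq → enum-injective i j (frobenius-injective
        (trans (sym (enum-index _)) (trans (reflexive (≡.cong enum eq)) (enum-index _))))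

    pth-root : Carrier → Carrier
    pth-root x = enum (proj₁ (frob-surjective (index x)))

    pth-root-^ : ∀ x → pth-root x ^ p ≈ x
    pth-root-^ x = trans (sym (enum-index _))
      (trans (reflexive (≡.cong enum (proj₂ (frob-surjective (index x))))) (enum-index x))

    private
      [m*k]×1≈0 : ∀ {k} m → k × 1# ≈ 0# → (m ℕ.* k) × 1# ≈ 0#
      [m*k]×1≈0 {k} m k×1≈0 = trans (×1-homo-* m k) (trans (*-congˡ k×1≈0) (zeroʳ _))

      1+[m*k]×1≈1 : ∀ {k} m → k × 1# ≈ 0# → (1 ℕ.+ m ℕ.* k) × 1# ≈ 1#
      1+[m*k]×1≈1 m k×1≈0 = trans (+-congˡ ([m*k]×1≈0 m k×1≈0)) (+-identityʳ 1#)

    p∤n⇒n×1≉0 : ∀ {n} → ¬ (p ℕ.∣ n) → ¬ (n × 1# ≈ 0#)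
    p∤n⇒n×1≉0 {n} p∤n n×1≈0 with coprime-Bézout n⊥p
      where
      n⊥p : Coprime n p
      n⊥p (d∣n , d∣p) with prime⇒irreducible p-prime d∣p
      ... | inj₁ d≡1    = d≡1
      ... | inj₂ ≡.refl = ⊥-elim (p∤n d∣n)
    ... | ℕ.Bézout.+- x y 1+yp≡xn = 1≉0 (begin
      1#                     ≈⟨ 1+[m*k]×1≈1 y p×1≈0 ⟨
      (1 ℕ.+ y ℕ.* p) × 1#   ≡⟨ ≡.cong (_× 1#) 1+yp≡xn ⟩
      (x ℕ.* n) × 1#         ≈⟨ [m*k]×1≈0 x n×1≈0 ⟩
      0#                     ∎)
    ... | ℕ.Bézout.-+ x y 1+xn≡yp = 1≉0 (begin
      1#                     ≈⟨ 1+[m*k]×1≈1 x n×1≈0 ⟨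
      (1 ℕ.+ x ℕ.* n) × 1#   ≡⟨ ≡.cong (_× 1#) 1+xn≡yp ⟩
      (y ℕ.* p) × 1#         ≈⟨ [m*k]×1≈0 y p×1≈0 ⟩
      0#                     ∎)

module FieldPolynomial {c ℓ : Level} (F : CommutativeRing c ℓ) (isField : IsField F)
                       (_≟_ : ∀ x y → Dec (CommutativeRing._≈_ F x y)) where
  open CommutativeRing F hiding (zero)
  open Polynomial F
  open Field F isField
  open import Algebra.Properties.Semiring.Primality R[X].semiring using (mkPrime) renaming (Prime to Primeₚ)
  open import Algebra.Properties.Group R[X].+-group using (//-rightDividesˡ; //-rightDividesʳ)
  open import Algebra.Properties.Ring R[X].ring using (-‿distribˡ-*)
  open import Algebra.Solver.Ring.NaturalCoefficients.Default R[X].commutativeSemiring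
  ≋[]? : ∀ P → Dec (P ≋ [])
  ≋[]? []      = yes ≋-refl
  ≋[]? (a ∷ P) with a ≟ 0# | ≋[]? P
  ... | yes a≈0 | yes P≋[] = yes (∷-≋[] a≈0 P≋[])
  ... | no  a≉0 | _        = no λ aP≋[] → a≉0 (coeff-≈ aP≋[] 0)
  ... | _       | no  P≉[] = no λ aP≋[] → P≉[] (∷≋[]⇒≋[] aP≋[])

  record Degree (P : Poly) (d : ℕ) : Set ℓ where
    constructor mkDegree
    field
      lead≉0 : ¬ (coeff P d ≈ 0#)
      deg≤   : Deg≤ P d
  open Degree public

  degree : ∀ P → ¬ (P ≋ []) → ∃ (Degree P)
  degree []      P≉[]  = ⊥-elim (P≉[] ≋-refl)
  degree (a ∷ P) aP≉[] with ≋[]? P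
  ... | yes P≋[] = 0 , mkDegree (λ a≈0 → aP≉[] (∷-≋[] a≈0 P≋[]))
                                (mkDeg≤ λ where (suc j) _ → coeff-≈ P≋[] j)
  ... | no  P≉[] with degree P P≉[]
  ...   | d , mkDegree lead≉0 P≤d = suc d , mkDegree lead≉0 (Deg≤-∷ P≤d)

  Degree⇒≉[] : ∀ {P d} → Degree P d → ¬ (P ≋ [])
  Degree⇒≉[] {d = d} P-deg P≋[] = lead≉0 P-deg (coeff-≈ P≋[] d)

  coeff≉0⇒≤ : ∀ {P n d} → ¬ (coeff P n ≈ 0#) → Deg≤ P d → n ≤ d
  coeff≉0⇒≤ {n = n} {d} Pn≉0 P≤d with ℕ.≤-<-connex n d
  ... | inj₁ n≤d = n≤d
  ... | inj₂ d<n = ⊥-elim (Pn≉0 (coeff-> P≤d n d<n))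

  Degree-*ₚ : ∀ {P Q d e} → Degree P d → Degree Q e → Degree (P *ₚ Q) (d ℕ.+ e)
  Degree-*ₚ (mkDegree P-lead≉0 P≤d) (mkDegree Q-lead≉0 Q≤e) = mkDegree
    (λ PQ-lead≈0 → *-≉0 P-lead≉0 Q-lead≉0 (trans (sym (coeff-*ₚ-top P≤d Q≤e)) PQ-lead≈0))
    (Deg≤-*ₚ P≤d Q≤e)

  *ₚ-≉[] : ∀ {P Q} → ¬ (P ≋ []) → ¬ (Q ≋ []) → ¬ ((P *ₚ Q) ≋ [])
  *ₚ-≉[] {P} {Q} P≉[] Q≉[] with degree P P≉[] | degree Q Q≉[]
  ... | _ , P-deg | _ , Q-deg = Degree⇒≉[] (Degree-*ₚ P-deg Q-deg)

  *ₚ≋[]⇒≋[] : ∀ {P Q} → ¬ (P ≋ []) → (P *ₚ Q) ≋ [] → Q ≋ []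
  *ₚ≋[]⇒≋[] {P} {Q} P≉[] PQ≋[] with ≋[]? Q
  ... | yes Q≋[] = Q≋[]
  ... | no  Q≉[] = ⊥-elim (*ₚ-≉[] P≉[] Q≉[] PQ≋[])

  ^ₚ-≉[] : ∀ {P} n → ¬ (P ≋ []) → ¬ ((P ^ₚ n) ≋ [])
  ^ₚ-≉[] zero    _    1≋[] = 1≉0 (coeff-≈ 1≋[] 0)
  ^ₚ-≉[] (suc n) P≉[]      = *ₚ-≉[] P≉[] (^ₚ-≉[] n P≉[])

  monomial : ℕ → Carrier → Poly
  monomial k u = (Xₚ ^ₚ k) *ₚ (u ∷ [])

  Deg≤-monomial : ∀ k u → Deg≤ (monomial k u) k
  Deg≤-monomial k u = ≡.subst (Deg≤ (monomial k u)) (ℕ.+-identityʳ k) (Deg≤-X^*ₚ k (Deg≤-const u))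

  coeff-monomial : ∀ k u → coeff (monomial k u) k ≈ u
  coeff-monomial k u = ≡.subst (λ i → coeff (monomial k u) i ≈ u) (ℕ.+-identityʳ k) (coeff-X^*ₚ-+ k (u ∷ []) 0)

  cancel-top : ∀ {G d n A} → Degree G d → d ≤ n → Deg≤ A n →
    ∃ λ M → ∀ j → n ≤ j → coeff (A +ₚ (-ₚ (M *ₚ G))) j ≈ 0#
  cancel-top {G} {d} {n} {A} (mkDegree G-lead≉0 G≤d) d≤n A≤n = M , top≈0
    where
    open Reasoning setoid
    lead⁻¹ = proj₁ (proj₂ isField (coeff G d) G-lead≉0)
    u = coeff A n * lead⁻¹
    M = monomial (n ∸ d) u
    n∸d+d≡n : n ∸ d ℕ.+ d ≡ n
    n∸d+d≡n = ℕ.m∸n+n≡m d≤n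
    MG≤n : Deg≤ (M *ₚ G) n
    MG≤n = ≡.subst (Deg≤ (M *ₚ G)) n∸d+d≡n (Deg≤-*ₚ (Deg≤-monomial (n ∸ d) u) G≤d)
    coeff-MG : coeff (M *ₚ G) n ≈ coeff A n
    coeff-MG = begin
      coeff (M *ₚ G) n                   ≡⟨ ≡.cong (coeff (M *ₚ G)) n∸d+d≡n ⟨
      coeff (M *ₚ G) (n ∸ d ℕ.+ d)       ≈⟨ coeff-*ₚ-top (Deg≤-monomial (n ∸ d) u) G≤d ⟩
      coeff M (n ∸ d) * coeff G d        ≈⟨ *-congʳ (coeff-monomial (n ∸ d) u) ⟩
      (coeff A n * lead⁻¹) * coeff G d   ≈⟨ *-assoc _ _ _ ⟩
      coeff A n * (lead⁻¹ * coeff G d)   ≈⟨ *-congˡ (trans (*-comm _ _) (proj₂ (proj₂ isField (coeff G d) G-lead≉0))) ⟩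
      coeff A n * 1#                     ≈⟨ *-identityʳ _ ⟩
      coeff A n                          ∎
    top≈0 : ∀ j → n ≤ j → coeff (A +ₚ (-ₚ (M *ₚ G))) j ≈ 0#
    top≈0 j n≤j with ℕ.≤⇒≤′ n≤j
    ... | ℕ.≤′-refl = trans (coeff-+ₚ A _ n)
      (trans (+-congˡ (trans (coeff--ₚ (M *ₚ G) n) (-‿cong coeff-MG))) (-‿inverseʳ _))
    ... | ℕ.≤′-step n<j = coeff-> (Deg≤-+ₚ A≤n (Deg≤--ₚ MG≤n)) j (s≤s (ℕ.≤′⇒≤ n<j))

  record Division (A G : Poly) (d : ℕ) : Set (c ⊔ ℓ) where
    constructor mkDivision
    field
      quotient remainder : Poly
      A≋qG+r             : A ≋ ((quotient *ₚ G) +ₚ remainder)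
      remainder<d        : ∀ j → d ≤ j → coeff remainder j ≈ 0#

  Division-shift : ∀ {A G d} M → Division (A +ₚ (-ₚ (M *ₚ G))) G d → Division A G d
  Division-shift {A} {G} M (mkDivision s r A′≋sG+r r<d) = mkDivision (s +ₚ M) r A≋ r<d
    where
    open Reasoning ≋-setoid
    A≋ : A ≋ (((s +ₚ M) *ₚ G) +ₚ r)
    A≋ = begin
      A                                   ≈⟨ //-rightDividesˡ (M *ₚ G) A ⟨
      (A +ₚ (-ₚ (M *ₚ G))) +ₚ (M *ₚ G)
        ≈⟨ +ₚ-cong A′≋sG+r (≋-refl {M *ₚ G}) ⟩
      ((s *ₚ G) +ₚ r) +ₚ (M *ₚ G)
        ≈⟨ solve 4 (λ s g r m → ((s :* g) :+ r) :+ (m :* g) := ((s :+ m) :* g) :+ r) ≋-refl s G r M ⟩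
      ((s +ₚ M) *ₚ G) +ₚ r ∎

  divide : ∀ {G d} → Degree G d → ∀ n A → Deg≤ A n → Division A G d
  divide {G} {d} G-deg n A A≤n with ℕ.<-≤-connex n d
  ... | inj₁ n<d = mkDivision [] A ≋-refl (λ j d≤j → coeff-> A≤n j (ℕ.<-≤-trans n<d d≤j))
  ... | inj₂ d≤n with cancel-top G-deg d≤n A≤n
  ...   | M , top≈0 = Division-shift M (A′-division n top≈0)
    where
    A′ = A +ₚ (-ₚ (M *ₚ G))
    A′-division : ∀ n → (∀ j → n ≤ j → coeff A′ j ≈ 0#) → Division A′ G d
    A′-division zero    top≈0 = mkDivision [] A′ ≋-refl (λ j _ → top≈0 j z≤n)
    A′-division (suc n) top≈0 = divide G-deg n A′ (mkDeg≤ λ j n<j → top≈0 j n<j)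

  Deg≤-length : ∀ P → Deg≤ P (length P)
  Deg≤-length []      = mkDeg≤ λ _ _ → refl
  Deg≤-length (a ∷ P) = Deg≤-∷ (Deg≤-length P)

  module Bézout (H A : Poly) where

    Combination : Poly → Set (c ⊔ ℓ)
    Combination w = ∃ λ U → ∃ λ V → w ≋ ((U *ₚ H) +ₚ (V *ₚ A))

    combination-H : Combination H
    combination-H = 1ₚ , [] , ≋-sym (≋-trans (+ₚ-identityʳ _) (*ₚ-identityˡ H))

    combination-A : Combination A
    combination-A = [] , 1ₚ , ≋-sym (*ₚ-identityˡ A)

    combination-cong : ∀ {x y} → x ≋ y → Combination x → Combination y
    combination-cong x≋y (U , V , x≋) = U , V , ≋-trans (≋-sym x≋y) x≋

    combination-sub : ∀ {X g} s → Combination X → Combination g → Combination (X +ₚ (-ₚ (s *ₚ g)))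
    combination-sub {X} {g} s (U′ , V′ , X≋) (U , V , g≋) = U′ +ₚ (-s *ₚ U) , V′ +ₚ (-s *ₚ V) , X-sg≋
      where
      open Reasoning ≋-setoid
      -s = -ₚ s
      X-sg≋ : (X +ₚ (-ₚ (s *ₚ g))) ≋ (((U′ +ₚ (-s *ₚ U)) *ₚ H) +ₚ ((V′ +ₚ (-s *ₚ V)) *ₚ A))
      X-sg≋ = begin
        X +ₚ (-ₚ (s *ₚ g))
          ≈⟨ +ₚ-cong X≋ (-‿distribˡ-* s g) ⟩
        ((U′ *ₚ H) +ₚ (V′ *ₚ A)) +ₚ (-s *ₚ g)
          ≈⟨ +ₚ-cong (≋-refl {(U′ *ₚ H) +ₚ (V′ *ₚ A)}) (*ₚ-congʳ -s g≋) ⟩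
        ((U′ *ₚ H) +ₚ (V′ *ₚ A)) +ₚ (-s *ₚ ((U *ₚ H) +ₚ (V *ₚ A)))
          ≈⟨ solve 7 (λ u′ v′ s u v h a → ((u′ :* h) :+ (v′ :* a)) :+ (s :* ((u :* h) :+ (v :* a)))
                                        := ((u′ :+ (s :* u)) :* h) :+ ((v′ :+ (s :* v)) :* a))
                     ≋-refl U′ V′ -s U V H A ⟩
        ((U′ +ₚ (-s *ₚ U)) *ₚ H) +ₚ ((V′ +ₚ (-s *ₚ V)) *ₚ A) ∎

    record LowerCombination (d : ℕ) : Set (c ⊔ ℓ) where
      constructor mkLowerCombination
      field
        {remainder}     : Poly
        {deg}           : ℕ
        degree-remainder : Degree remainder deg
        deg<d           : deg < d
        combination     : Combination remainder

    remainder-step : ∀ {X g d} → Combination X → Degree g d → Combination g → g ∣ X ⊎ LowerCombination d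
    remainder-step {X} {g} {d} X-comb g-deg g-comb with divide g-deg (length X) X (Deg≤-length X)
    ... | mkDivision s r X≋sg+r r<d with ≋[]? r
    ...   | yes r≋[] = inj₁ (s , ≋-sym (≋-trans X≋sg+r (≋-trans (+ₚ-cong (≋-refl {s *ₚ g}) r≋[]) (+ₚ-identityʳ _))))
    ...   | no  r≉[] with degree r r≉[]
    ...     | d′ , r-deg = inj₂ (mkLowerCombination r-deg d′<d (combination-cong r≋ (combination-sub s X-comb g-comb)))
      where
      d′<d : d′ < d
      d′<d with ℕ.<-≤-connex d′ d
      ... | inj₁ d′<d = d′<d
      ... | inj₂ d≤d′ = ⊥-elim (lead≉0 r-deg (r<d d′ d≤d′))
      r≋ : (X +ₚ (-ₚ (s *ₚ g))) ≋ r
      r≋ = ≋-trans (+ₚ-cong (≋-trans X≋sg+r (+ₚ-comm (s *ₚ g) r)) (≋-refl { -ₚ (s *ₚ g)}))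
                   (//-rightDividesʳ (s *ₚ g) r)

    record CommonDivisor : Set (c ⊔ ℓ) where
      constructor mkCommonDivisor
      field
        divisor     : Poly
        combination : Combination divisor
        divisor∣H   : divisor ∣ H
        divisor∣A   : divisor ∣ A

    commonDivisor : ∀ fuel {g d} → d < fuel → Degree g d → Combination g → CommonDivisor
    commonDivisor (suc fuel) {g} (s≤s d≤fuel) g-deg g-comb with remainder-step combination-H g-deg g-comb
    ... | inj₂ (mkLowerCombination r-deg d′<d r-comb) = commonDivisor fuel (ℕ.<-≤-trans d′<d d≤fuel) r-deg r-comb
    ... | inj₁ g∣H with remainder-step combination-A g-deg g-comb
    ...   | inj₂ (mkLowerCombination r-deg d′<d r-comb) = commonDivisor fuel (ℕ.<-≤-trans d′<d d≤fuel) r-deg r-comb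
    ...   | inj₁ g∣A = mkCommonDivisor g g-comb g∣H g∣A

  unit*w≋H∧w∣A⇒H∣A : ∀ {H w t A} → (t *ₚ w) ≋ H → IsUnitₚ t → w ∣ A → H ∣ A
  unit*w≋H∧w∣A⇒H∣A {H} {w} {t} {A} t*w≋H (t⁻¹ , t*t⁻¹≈1) (t′ , t′*w≋A) = t′ *ₚ t⁻¹ , (begin
    (t′ *ₚ t⁻¹) *ₚ H            ≈⟨ *ₚ-congʳ (t′ *ₚ t⁻¹) (≋-sym t*w≋H) ⟩
    (t′ *ₚ t⁻¹) *ₚ (t *ₚ w)     ≈⟨ solve 4 (λ a b c d → (a :* b) :* (c :* d) := a :* ((c :* b) :* d)) ≋-refl t′ t⁻¹ t w ⟩
    t′ *ₚ ((t *ₚ t⁻¹) *ₚ w)     ≈⟨ *ₚ-congʳ t′ (≋-trans (*ₚ-congˡ w (mk≋ {t *ₚ t⁻¹} t*t⁻¹≈1)) (*ₚ-identityˡ w)) ⟩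
    t′ *ₚ w                     ≈⟨ t′*w≋A ⟩
    A                           ∎)
    where open Reasoning ≋-setoid

  unit-combination⇒euclid : ∀ {H A B w U V} → IsUnitₚ w → w ≋ ((U *ₚ H) +ₚ (V *ₚ A)) → H ∣ (A *ₚ B) → H ∣ B
  unit-combination⇒euclid {H} {A} {B} {w} {U} {V} (w⁻¹ , w*w⁻¹≈1) w≋ (z , z*H≋AB) =
    ((w⁻¹ *ₚ U) *ₚ B) +ₚ ((w⁻¹ *ₚ V) *ₚ z) , (begin
    (((w⁻¹ *ₚ U) *ₚ B) +ₚ ((w⁻¹ *ₚ V) *ₚ z)) *ₚ H
      ≈⟨ solve 6 (λ w′ u b v z h → ((w′ :* u) :* b :+ (w′ :* v) :* z) :* h := w′ :* ((u :* h) :* b :+ v :* (z :* h)))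
                 ≋-refl w⁻¹ U B V z H ⟩
    w⁻¹ *ₚ (((U *ₚ H) *ₚ B) +ₚ (V *ₚ (z *ₚ H)))
      ≈⟨ *ₚ-congʳ w⁻¹ (+ₚ-cong (≋-refl {(U *ₚ H) *ₚ B}) (*ₚ-congʳ V z*H≋AB)) ⟩
    w⁻¹ *ₚ (((U *ₚ H) *ₚ B) +ₚ (V *ₚ (A *ₚ B)))
      ≈⟨ solve 6 (λ w′ u h v a b → w′ :* ((u :* h) :* b :+ v :* (a :* b)) := (w′ :* ((u :* h) :+ (v :* a))) :* b)
                 ≋-refl w⁻¹ U H V A B ⟩
    (w⁻¹ *ₚ ((U *ₚ H) +ₚ (V *ₚ A))) *ₚ B
      ≈⟨ *ₚ-congˡ B (≋-trans (*ₚ-congʳ w⁻¹ (≋-sym w≋)) (≋-trans (*ₚ-comm w⁻¹ w) (mk≋ {w *ₚ w⁻¹} w*w⁻¹≈1))) ⟩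
    1ₚ *ₚ B
      ≈⟨ *ₚ-identityˡ B ⟩
    B ∎)
    where open Reasoning ≋-setoid

  irreducible⇒prime : ∀ {H} → Irreducible H → Primeₚ H
  irreducible⇒prime {H} (H≉[] , H-nonunit , H-irreducible) = mkPrime (λ H≋[] → H≉[] (coeff-≈ H≋[]))
    (λ where (u , u*H≋1) → H-nonunit (u , coeff-≈ (≋-trans (*ₚ-comm H u) u*H≋1))) split
    where
    split : ∀ {A B} → H ∣ (A *ₚ B) → H ∣ A ⊎ H ∣ B
    split {A} {B} H∣AB with degree H (λ H≋[] → H≉[] (coeff-≈ H≋[]))
    ... | d , H-deg with Bézout.commonDivisor H A (suc d) (ℕ.n<1+n d) H-deg (Bézout.combination-H H A)
    ... | Bézout.mkCommonDivisor w (U , V , w≋) (t , t*w≋H) w∣A with H-irreducible t w (coeff-≈ (≋-sym t*w≋H))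
    ...   | inj₁ t-unit = inj₁ (unit*w≋H∧w∣A⇒H∣A {t = t} t*w≋H t-unit w∣A)
    ...   | inj₂ w-unit = inj₂ (unit-combination⇒euclid {A = A} {B} {w} {U} {V} w-unit w≋ H∣AB)

  ∣⇒deg≤ : ∀ {A B a b} → Degree A a → Degree B b → A ∣ B → a ≤ b
  ∣⇒deg≤ {A} {B} {a} {b} A-deg B-deg (s , s*A≋B)
    with degree s (λ s≋[] → Degree⇒≉[] B-deg (≋-trans (≋-sym s*A≋B) (*ₚ-zeroˡ A s≋[])))
  ... | d , s-deg = ℕ.≤-trans (ℕ.m≤n+m a d)
    (coeff≉0⇒≤ (λ B-top≈0 → lead≉0 (Degree-*ₚ s-deg A-deg) (trans (coeff-≈ s*A≋B (d ℕ.+ a)) B-top≈0)) (deg≤ B-deg))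

module Separability {c ℓ : Level} (F : CommutativeRing c ℓ) (isField : IsField F) {q : ℕ} (card : HasCardinality F q)
                    {p e : ℕ} (p-prime : Prime p) (q≡p^e : q ≡ p ℕ.^ e) where
  open CommutativeRing F hiding (zero)
  open Polynomial F
  open Taylor F using (derivative; coeff-derivative; coeff-derivative-≈0)
  open Field F isField
  open FiniteField F isField card
  open FiniteField.Characteristic F isField card {e = e} p-prime q≡p^e using (p×1≈0; pth-root; pth-root-^; p∤n⇒n×1≉0)
  open FieldPolynomial F isField _≟_
  open import Algebra.Properties.Semiring.Mult semiring using (_×_; ×-assoc-*; ×-congʳ)
  open import Algebra.Properties.Semiring.Exp semiring using (_^_)

  1≤p : 1 ≤ p
  1≤p = ℕ.<⇒≤ (prime>1 p-prime)

  IsPolyInXᵖ : Poly → Set ℓ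
  IsPolyInXᵖ P = ∀ j → ¬ (p ℕ.∣ j) → coeff P j ≈ 0#

  derivative≋[]⇒IsPolyInXᵖ : ∀ P → derivative P ≋ [] → IsPolyInXᵖ P
  derivative≋[]⇒IsPolyInXᵖ P D≋[] zero    p∤0   = ⊥-elim (p∤0 (ℕ.divides 0 ≡.refl))
  derivative≋[]⇒IsPolyInXᵖ P D≋[] (suc n) p∤n+1 = x*y≈0⇒y≈0 (p∤n⇒n×1≉0 p∤n+1) (begin
    (suc n × 1#) * coeff P (suc n)   ≈⟨ ×-assoc-* (suc n) 1# _ ⟩
    suc n × (1# * coeff P (suc n))   ≈⟨ ×-congʳ (suc n) (*-identityˡ _) ⟩
    suc n × coeff P (suc n)          ≈⟨ coeff-derivative P n ⟨
    coeff (derivative P) n           ≈⟨ coeff-≈ D≋[] n ⟩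
    0#                               ∎)
    where open Reasoning setoid

  IsPolyInXᵖ-drop : ∀ {P} → IsPolyInXᵖ P → IsPolyInXᵖ (drop p P)
  IsPolyInXᵖ-drop {P} P∈F[Xᵖ] j p∤j = trans (reflexive (coeff-drop p P j))
    (P∈F[Xᵖ] (p ℕ.+ j) (λ p∣p+j → p∤j (ℕ.∣m+n∣m⇒∣n p∣p+j ℕ.∣-refl)))

  IsPolyInXᵖ⇒≋ : ∀ {P} → IsPolyInXᵖ P → P ≋ ((coeff P 0 ∷ []) +ₚ ((Xₚ ^ₚ p) *ₚ drop p P))
  IsPolyInXᵖ⇒≋ {P} P∈F[Xᵖ] = mk≋ λ j → sym (trans (coeff-+ₚ (coeff P 0 ∷ []) ((Xₚ ^ₚ p) *ₚ W) j) (coeff≈ j))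
    where
    W = drop p P
    coeff≈ : ∀ j → coeff (coeff P 0 ∷ []) j + coeff ((Xₚ ^ₚ p) *ₚ W) j ≈ coeff P j
    coeff≈ zero    = trans (+-congˡ (coeff-X^*ₚ-< p W 1≤p)) (+-identityʳ _)
    coeff≈ (suc j) with ℕ.<-≤-connex (suc j) p
    ... | inj₁ j+1<p = trans (+-identityˡ _) (trans (coeff-X^*ₚ-< p W j+1<p)
                         (sym (P∈F[Xᵖ] (suc j) (λ p∣j+1 → ℕ.<⇒≱ j+1<p (ℕ.∣⇒≤ p∣j+1)))))
    ... | inj₂ p≤j+1 = trans (+-identityˡ _) (begin
      coeff ((Xₚ ^ₚ p) *ₚ W) (suc j)              ≡⟨ ≡.cong (coeff ((Xₚ ^ₚ p) *ₚ W)) p+k≡j+1 ⟨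
      coeff ((Xₚ ^ₚ p) *ₚ W) (p ℕ.+ k)            ≈⟨ coeff-X^*ₚ-+ p W k ⟩
      coeff W k                                   ≡⟨ coeff-drop p P k ⟩
      coeff P (p ℕ.+ k)                           ≡⟨ ≡.cong (coeff P) p+k≡j+1 ⟩
      coeff P (suc j)                             ∎)
      where
      open Reasoning setoid
      k = suc j ∸ p
      p+k≡j+1 : p ℕ.+ k ≡ suc j
      p+k≡j+1 = ℕ.m+[n∸m]≡n p≤j+1

  frobenius-p-+ₚ : ∀ x y → ((x +ₚ y) ^ₚ p) ≋ ((x ^ₚ p) +ₚ (y ^ₚ p))
  frobenius-p-+ₚ x y = ≡.subst (λ k → ((x +ₚ y) ^ₚ k) ≋ ((x ^ₚ k) +ₚ (y ^ₚ k))) (ℕ.*-identityʳ p)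
    (frobenius-+ₚ p-prime p×1≈0 1 x y)

  -- The p-th root of Σᵢ aᵢ X^(p i) is Σᵢ aᵢ^(1/p) Xⁱ (computed with fuel f).
  pthRootₚ : ℕ → Poly → Poly
  pthRootₚ zero    P = []
  pthRootₚ (suc f) P = pth-root (coeff P 0) ∷ pthRootₚ f (drop p P)

  pthRootₚ-^ : ∀ f P → length P ≤ f → IsPolyInXᵖ P → (pthRootₚ f P ^ₚ p) ≋ P
  pthRootₚ-^ zero    []      _       _       = []^ₚ p 1≤p
    where
    []^ₚ : ∀ n → 1 ≤ n → ([] ^ₚ n) ≋ []
    []^ₚ (suc n) _ = ≋-refl
  pthRootₚ-^ (suc f) P       |P|≤f+1 P∈F[Xᵖ] = begin
    (r ∷ G) ^ₚ p
      ≈⟨ ^ₚ-cong p (constant+X*tail (r ∷ G)) ⟩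
    ((r ∷ []) +ₚ (Xₚ *ₚ G)) ^ₚ p
      ≈⟨ frobenius-p-+ₚ (r ∷ []) (Xₚ *ₚ G) ⟩
    ((r ∷ []) ^ₚ p) +ₚ ((Xₚ *ₚ G) ^ₚ p)
      ≈⟨ +ₚ-cong (const-^ₚ r p) (^ₚ-distrib-*ₚ Xₚ G p) ⟩
    ((pth-root (coeff P 0) ^ p) ∷ []) +ₚ ((Xₚ ^ₚ p) *ₚ (G ^ₚ p))
      ≈⟨ +ₚ-cong (∷-cong (pth-root-^ (coeff P 0)) ≋-refl) (*ₚ-congʳ (Xₚ ^ₚ p) G^p≋W) ⟩
    (coeff P 0 ∷ []) +ₚ ((Xₚ ^ₚ p) *ₚ drop p P)
      ≈⟨ IsPolyInXᵖ⇒≋ P∈F[Xᵖ] ⟨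
    P ∎
    where
    open Reasoning ≋-setoid
    r = pth-root (coeff P 0)
    G = pthRootₚ f (drop p P)
    |W|≤f : length (drop p P) ≤ f
    |W|≤f = ℕ.≤-trans (ℕ.≤-reflexive (length-drop p P))
                      (ℕ.≤-trans (ℕ.∸-monoˡ-≤ p |P|≤f+1) (ℕ.∸-monoʳ-≤ (suc f) 1≤p))
    G^p≋W : (G ^ₚ p) ≋ drop p P
    G^p≋W = pthRootₚ-^ f (drop p P) |W|≤f (IsPolyInXᵖ-drop P∈F[Xᵖ])

  derivative-deg< : ∀ {H d d′} → Degree H d → Degree (derivative H) d′ → d′ < d
  derivative-deg< {H} {d′ = d′} (mkDegree _ H≤d) (mkDegree D-lead≉0 _) = coeff≉0⇒≤ H-coeff≉0 H≤d
    where
    H-coeff≉0 : ¬ (coeff H (suc d′) ≈ 0#)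
    H-coeff≉0 H-coeff≈0 = D-lead≉0 (coeff-derivative-≈0 H d′ H-coeff≈0)

  -- If H′ = 0 then H is a p-th power, because F is perfect; otherwise deg H′ < deg H.
  irreducible⇒∤derivative : ∀ {H} → Irreducible H → ¬ (H ∣ derivative H)
  irreducible⇒∤derivative {H} H-irreducible H∣D with ≋[]? (derivative H)
  ... | yes D≋[] = irreducible⇒≉^ₚ (prime>1 p-prime) H-irreducible
                     (≋-sym (pthRootₚ-^ (length H) H ℕ.≤-refl (derivative≋[]⇒IsPolyInXᵖ H D≋[])))
  ... | no  D≉[] with degree H H≉[] | degree (derivative H) D≉[]
    where H≉[] = λ H≋[] → proj₁ H-irreducible (coeff-≈ H≋[])
  ...   | d , H-deg | d′ , D-deg = ℕ.<⇒≱ (derivative-deg< H-deg D-deg) (∣⇒deg≤ H-deg D-deg H∣D)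

module Multiplicity {c ℓ : Level} (F : CommutativeRing c ℓ) (isField : IsField F)
                    {p e : ℕ} (p-prime : Prime p) (card : HasCardinality F (p ℕ.^ e)) where
  open Polynomial F
  open Taylor F using (taylor; taylor-cong; derivative; coeff-taylor-^ₚ*ₚ≡; module Y)
  open TaylorCharP F p-prime e using (q; Deg≤Mod⇒coeff≈0; Deg≤Mod-taylor-Λ-combination; coeff-taylor-^q*ₚ)
  open FiniteField F isField card using (_≟_)
  open FiniteField.Characteristic F isField card {e = e} p-prime ≡.refl using (p×1≈0)
  open FieldPolynomial F isField _≟_ using (irreducible⇒prime; *ₚ≋[]⇒≋[]; ^ₚ-≉[])
  open Separability F isField card {e = e} p-prime ≡.refl using (irreducible⇒∤derivative)
  open Congruence +ₚ-*ₚ-commutativeRing using (≡0⇒∣; ≡mod-trans; ≡mod-sym; ≈⇒≡mod)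
  open import Algebra.Properties.Semiring.Primality R[X].semiring using () renaming (module Prime to Primeₚ)
  open import Algebra.Solver.Ring.NaturalCoefficients.Default R[X].commutativeSemiring

  module _ {H : Poly} (H-irreducible : Irreducible H) where
    open Primeₚ (irreducible⇒prime {H} H-irreducible) using (p∤1; split-∣)

    ∤derivative^ₚ : ∀ m → ¬ (H ∣ (derivative H ^ₚ m))
    ∤derivative^ₚ zero    = p∤1
    ∤derivative^ₚ (suc m) H∣D^m+1 with split-∣ H∣D^m+1
    ... | inj₁ H∣D   = irreducible⇒∤derivative H-irreducible H∣D
    ... | inj₂ H∣D^m = ∤derivative^ₚ m H∣D^m

    coeff-taylor≋[]⇒∣ : ∀ m W → Y.coeff (taylor ((H ^ₚ m) *ₚ W)) m ≋ [] → H ∣ W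
    coeff-taylor≋[]⇒∣ m W coeff≋[]
      with split-∣ (≡0⇒∣ (≡mod-trans (≡mod-sym (coeff-taylor-^ₚ*ₚ≡ H m W)) (≈⇒≡mod coeff≋[])))
    ... | inj₁ H∣D^m = ⊥-elim (∤derivative^ₚ m H∣D^m)
    ... | inj₂ H∣W   = H∣W

    ^ₚ-split : ∀ μ a m r → μ ≡ m ℕ.+ a ℕ.* q → (r *ₚ (H ^ₚ μ)) ≋ (((H ^ₚ a) ^ₚ q) *ₚ ((H ^ₚ m) *ₚ r))
    ^ₚ-split μ a m r ≡.refl =
      ≋-trans (*ₚ-congʳ r (≋-trans (^ₚ-+ H m (a ℕ.* q)) (*ₚ-congʳ (H ^ₚ m) (≋-sym (^ₚ-* H a q)))))
      (solve 3 (λ r x y → r :* (x :* y) := y :* (x :* r)) ≋-refl r (H ^ₚ m) ((H ^ₚ a) ^ₚ q))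

    module _ (k t : ℕ) (Cs : Fin t → Poly) (Cs≤k : ∀ i → DegLe (Cs i) k) {C : Poly}
             (C≋ : C ≋ sumₚ t (λ i → Cs i *ₚ (Λ q ^ₚ toℕ i))) where

      coeff-taylor-≋[] : ∀ {j} → k ℕ.+ t ∸ 1 < j → j < q → Y.coeff (taylor C) j ≋ []
      coeff-taylor-≋[] {j} k+t∸1<j j<q = ≋-trans (Y.coeff-≈ (taylor-cong C≋) j)
        (mk≋ (coeff-≈ (Deg≤Mod⇒coeff≈0 (Deg≤Mod-taylor-Λ-combination p×1≈0 k t Cs Cs≤k) k+t∸1<j j<q)))

      multiplicity-step : ∀ μ a m → μ ≡ m ℕ.+ a ℕ.* q → m < q → k ℕ.+ t ∸ 1 < m →
        (H ^ₚ μ) ∣ C → (H ^ₚ suc μ) ∣ C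
      multiplicity-step μ a m μ≡ m<q k+t∸1<m (r , r*H^μ≋C) =
        H∣r⇒H^μ+1∣C (coeff-taylor≋[]⇒∣ m r (*ₚ≋[]⇒≋[] Gq≉[] Gq*coeff≋[]))
        where
        open Reasoning ≋-setoid
        Gq = (H ^ₚ a) ^ₚ q
        S  = (H ^ₚ m) *ₚ r
        Gq≉[] : ¬ (Gq ≋ [])
        Gq≉[] = ^ₚ-≉[] q (^ₚ-≉[] a (λ H≋[] → proj₁ H-irreducible (coeff-≈ H≋[])))
        Gq*coeff≋[] : (Gq *ₚ Y.coeff (taylor S) m) ≋ []
        Gq*coeff≋[] = begin
          Gq *ₚ Y.coeff (taylor S) m        ≈⟨ coeff-taylor-^q*ₚ p×1≈0 (H ^ₚ a) S m<q ⟨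
          Y.coeff (taylor (Gq *ₚ S)) m      ≈⟨ Y.coeff-≈ (taylor-cong (≋-trans (≋-sym (^ₚ-split μ a m r μ≡)) r*H^μ≋C)) m ⟩
          Y.coeff (taylor C) m              ≈⟨ coeff-taylor-≋[] k+t∸1<m m<q ⟩
          []                                ∎
        H∣r⇒H^μ+1∣C : H ∣ r → (H ^ₚ suc μ) ∣ C
        H∣r⇒H^μ+1∣C (s , s*H≋r) = s , (begin
          s *ₚ (H *ₚ (H ^ₚ μ))    ≈⟨ *ₚ-assoc s H (H ^ₚ μ) ⟨
          (s *ₚ H) *ₚ (H ^ₚ μ)    ≈⟨ *ₚ-congˡ (H ^ₚ μ) s*H≋r ⟩
          r *ₚ (H ^ₚ μ)           ≈⟨ r*H^μ≋C ⟩
          C                       ∎)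

open import Data.Nat using (_+_)
open import Data.Nat.DivMod using (_%_; _/_; m%n<n; m≡m%n+[m/n]*n)

lemma3p3 : ∀ {c ℓ} (F : CommutativeRing c ℓ) → IsField F →
    (q : ℕ) → .{{_ : NonZero q}} → IsPrimePower q → HasCardinality F q →
    (k t : ℕ) → k < q → 1 ≤ t →
    (Cs : Fin t → Poly.Poly F) → (∀ i → Poly.DegLe F (Cs i) k) →
    (C : Poly.Poly F) →
    Poly._≈ₚ_ F C (Poly.sumₚ F t (λ i → Poly._*ₚ_ F (Cs i) (Poly._^ₚ_ F (Poly.Λ F q) (toℕ i)))) →
    ¬ Poly._≈ₚ_ F C (Poly.0ₚ F) →
    (H : Poly.Poly F) → Poly.Irreducible F H →
    (μ : ℕ) → Poly._∣ₚ_ F (Poly._^ₚ_ F H μ) C → ¬ Poly._∣ₚ_ F (Poly._^ₚ_ F H (suc μ)) C →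
    μ % q ≤ k + t ∸ 1
lemma3p3 F isField q (p , e , p-prime , _ , ≡.refl) card k t _ _ Cs Cs≤k C C≈ _ H H-irreducible μ H^μ∣C H^μ+1∤C =
  ℕ.≮⇒≥ λ k+t∸1<μ%q → H^μ+1∤C (∣⇒∣ₚ (multiplicity-step H-irreducible k t Cs Cs≤k (mk≋ {C} C≈)
    μ (μ / q) (μ % q) (m≡m%n+[m/n]*n μ q) (m%n<n μ q) k+t∸1<μ%q (∣ₚ⇒∣ H^μ∣C)))
  where
  open Polynomial F using (mk≋; ∣ₚ⇒∣; ∣⇒∣ₚ)
  open Multiplicity F isField {e = e} p-prime card using (multiplicity-step)
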